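{- Let $e\ge2$ and $\mathbf c=(0,1,\dots,e-1)$. The map $w\mapsto w\cdot\boldsymbol\emptyset$, where $\boldsymbol\emptyset=(\emptyset_0,\emptyset_1,\dots,\emptyset_{e-1})$ and $\tilde{\mathfrak S}_e$ acts diagonally, is a bijection from $\tilde{\mathfrak S}_e$ onto the set of $(e,\mathbf c)$-cores.
   Context: The affine symmetric group $\tilde{\mathfrak S}_e$ is the group of bijections $w:\mathbb Z\to\mathbb Z$ with $w(i+e)=w(i)+e$ and $w(1)+\dots+w(e)=e(e+1)/2$. A $c$-charged partition is a partition $\lambda=(\lambda_1\ge\dots\ge\lambda_h>0)$ with an integer $c$; its abacus is $\{\lambda_k-k+c+1:k\ge1\}$ ($\lambda_k=0$ for $k>h$), and every subset of $\mathbb Z$ containing all sufficiently negative and no sufficiently large integers is the abacus of a unique charged partition. $w\cdot\lambda$ is the charged partition with abacus $w(A)$, $A$ the abacus of $\lambda$; $\emptyset_c$ is the empty $c$-charged partition. An $(e,\mathbf c)$-core is an $e$-tuple $(\lambda^{(0)},\dots,\lambda^{(e-1)})$ where $\lambda^{(k)}$ is a $k$-charged partition with abacus $A_k$, such that $A_0\subseteq A_1\subseteq\dots\subseteq A_{e-1}\subseteq A_0+e$. The diagonal action is $w\cdot(\lambda^{(0)},\dots,\lambda^{(e-1)})=(w\cdot\lambda^{(0)},\dots,w\cdot\lambda^{(e-1)})$, which preserves $(e,\mathbf c)$-cores. -}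

module Defs where

open import Data.Nat as ℕ using (ℕ; zero; suc; _≥_; _<_)
open import Data.Nat.Properties as ℕP using ()
open import Data.Integer as ℤ using (ℤ; +_)
open import Data.Fin as Fin using (Fin; toℕ; fromℕ<)
open import Data.List using (List; []; _∷_)
open import Data.List.Relation.Unary.All using (All)
open import Data.List.Relation.Unary.Linked using (Linked)
open import Data.Product using (Σ; ∃; ∃-syntax; _×_; _,_)
open import Function.Definitions using (Bijective)
open import Relation.Binary.PropositionalEquality using (_≡_)

sumW : (ℤ → ℤ) → ℕ → ℤ
sumW w zero    = + 0
sumW w (suc n) = sumW w n ℤ.+ w (+ suc n)

record IsAffinePerm (e : ℕ) (w : ℤ → ℤ) : Set where
  field
    bijective : Bijective _≡_ _≡_ w
    periodic  : ∀ (i : ℤ) → w (i ℤ.+ + e) ≡ w i ℤ.+ + e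
    sumCond   : sumW w e ≡ + ((e ℕ.* suc e) ℕ./ 2)

record Partition : Set where
  constructor mkPartition
  field
    parts      : List ℕ
    decreasing : Linked _≥_ parts
    positive   : All (0 <_) parts
open Partition public

emptyP : Partition
emptyP = mkPartition [] Linked.[] All.[]
  where import Data.List.Relation.Unary.Linked as Linked
        import Data.List.Relation.Unary.All as All

-- λ_{i+1} (0-based lookup, with λ_k = 0 beyond the length)
at : List ℕ → ℕ → ℕ
at []       _       = 0
at (x ∷ xs) zero    = x
at (x ∷ xs) (suc i) = at xs i

Subset : Set₁
Subset = ℤ → Set

_⊆_ : Subset → Subset → Set
A ⊆ B = ∀ x → A x → B x

_≐_ : Subset → Subset → Set
A ≐ B = (A ⊆ B) × (B ⊆ A)

image : (ℤ → ℤ) → Subset → Subset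
image w A x = ∃[ a ] (A a × w a ≡ x)

shift : ℕ → Subset → Subset
shift e A x = ∃[ a ] (A a × x ≡ a ℤ.+ + e)

-- abacus of the c-charged partition λ: { λ_k - k + c + 1 : k ≥ 1 }
-- (written with k = suc i)
abacus : ℤ → Partition → Subset
abacus c λ' x = ∃[ i ] (x ≡ ((+ at (parts λ') i ℤ.- + suc i) ℤ.+ c) ℤ.+ + 1)

-- e-tuples of charged partitions with charges c = (0,1,...,e-1):
-- the k-th component is a k-charged partition.

Tuple : ℕ → Set
Tuple e = Fin e → Partition

charge : ∀ {e} → Fin e → ℤ
charge k = + toℕ k

Ab : ∀ {e} → Tuple e → Fin e → Subset
Ab μ k = abacus (charge k) (μ k)

-- (e, c)-core: A_0 ⊆ A_1 ⊆ ... ⊆ A_{e-1} ⊆ A_0 + e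
record IsCore (e : ℕ) (μ : Tuple e) : Set where
  field
    chain : ∀ (k : ℕ) (p : suc k < e) →
            Ab μ (fromℕ< (ℕP.<-trans (ℕP.n<1+n k) p)) ⊆ Ab μ (fromℕ< p)
    wrap  : ∀ (p₀ : 0 < e) (pₗ : ℕ.pred e < e) →
            Ab μ (fromℕ< pₗ) ⊆ shift e (Ab μ (fromℕ< p₀))

-- ActsEmpty e w μ : μ = w · ∅, i.e. for every k the abacus of the
-- k-th component of μ equals w applied to the abacus of ∅_k.
-- (A charged partition is determined by its abacus, so this relation
-- characterises w · ∅ uniquely.)
ActsEmpty : (e : ℕ) → (ℤ → ℤ) → Tuple e → Set
ActsEmpty e w μ = ∀ (k : Fin e) → Ab μ k ≐ image w (abacus (charge k) emptyP)

module Submission where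

-- For an affine permutation w the abaci Bᵢ = w((-∞, i]) of w · ∅ᵢ increase by exactly one bead,
-- w (i + 1), at each step, and B_{i+e} = Bᵢ + e. Conversely, the abaci of the components of an
-- (e, c)-core, translated by the multiples of e, form such a family indexed by ℤ; the charge of Bᵢ
-- is i, so each step adds exactly one bead, and that bead defines w (i + 1). In both directions the
-- sum condition and the charges are tied by Σ_{i=1}^{e} w i = e · charge(B₀) + e(e+1)/2, found by
-- comparing the bead sums of B_e = B₀ + e and B₀ in a window. Uniqueness: w i is the only bead of
-- Bᵢ missing from B_{i-1}.

open import Defs

module AffineCores where

  open import Data.Nat as ℕ using (ℕ; zero; suc; z≤n; s≤s)
  import Data.Nat.Properties as ℕₚ
  open import Data.Nat.DivMod using (m*n/n≡m)
  import Data.Nat.Tactic.RingSolver as ℕ-Solver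
  open import Data.Integer as ℤ using (ℤ; +_; -[1+_]; _+_; _*_; _-_; -_; _≤_; _<_; _≤?_; _≟_; +≤+; +<+; -≤+; ∣_∣)
  open import Data.Integer.Properties
  open import Data.Integer.DivMod using (_/ℕ_; a≡a%ℕn+[a/ℕn]*n; n%ℕd<d)
  open import Data.Integer.Tactic.RingSolver using (solve-∀)
  open import Data.Fin as Fin using (Fin; toℕ; fromℕ<)
  import Data.Fin.Properties as Finₚ
  open import Data.List using (List; []; _∷_; length)
  open import Data.List.Relation.Unary.Linked as Linked using (Linked; [-])
  open import Data.List.Relation.Unary.All as All using (All)
  open import Data.Product using (∃-syntax; _×_; _,_; proj₁; proj₂)
  open import Data.Sum using (_⊎_; inj₁; inj₂; [_,_])
  open import Data.Empty using (⊥; ⊥-elim)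
  open import Relation.Nullary using (¬_; Dec; yes; no)
  open import Relation.Nullary.Decidable using (_⊎-dec_)
  open import Relation.Unary using (Decidable)
  open import Relation.Binary.Definitions using (tri<; tri≈; tri>)
  open import Relation.Binary.PropositionalEquality
    using (_≡_; _≢_; refl; sym; trans; cong; cong₂; subst; subst₂; module ≡-Reasoning)
  open import Function using (_∘_)
  open import Algebra.Properties.AbelianGroup +-0-abelianGroup using (∙-cancelˡ; ∙-cancelʳ)

  ≤⇒∃ : ∀ {i j} → i ≤ j → ∃[ k ] j ≡ i + + k
  ≤⇒∃ {i} {j} i≤j = ∣ j - i ∣ , sym (begin
    i + + ∣ j - i ∣  ≡⟨ cong (_+_ i) (0≤i⇒+∣i∣≡i (i≤j⇒0≤j-i i≤j)) ⟩
    i + (j - i)      ≡⟨ i+[j-i]≡j i j ⟩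
    j                ∎)
    where
    open ≡-Reasoning
    i+[j-i]≡j : ∀ i j → i + (j - i) ≡ j
    i+[j-i]≡j = solve-∀

  ≡+⇒≤ : ∀ {i j} k → j ≡ i + + k → i ≤ j
  ≡+⇒≤ {i} k refl = i≤i+j i (+ k)

  <⇒∃ : ∀ {i j} → i < j → ∃[ k ] j ≡ i + + suc k
  <⇒∃ {i} p with ≤⇒∃ (i<j⇒suc[i]≤j p)
  ... | k , refl = k , 1+i+k≡i+[1+k] i (+ k)
    where
    1+i+k≡i+[1+k] : ∀ i k → + 1 + i + k ≡ i + (+ 1 + k)
    1+i+k≡i+[1+k] = solve-∀

  ≡+suc⇒< : ∀ {i j} k → j ≡ i + + suc k → i < j
  ≡+suc⇒< {i} k refl = suc[i]≤j⇒i<j (≡+⇒≤ k (i+[1+k]≡1+i+k i (+ k)))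
    where
    i+[1+k]≡1+i+k : ∀ i k → i + (+ 1 + k) ≡ + 1 + i + k
    i+[1+k]≡1+i+k = solve-∀

  +suc≡1++ : ∀ a n → a + + suc n ≡ + 1 + (a + + n)
  +suc≡1++ a n = a+[1+n]≡1+[a+n] a (+ n)
    where
    a+[1+n]≡1+[a+n] : ∀ a n → a + (+ 1 + n) ≡ + 1 + (a + n)
    a+[1+n]≡1+[a+n] = solve-∀

  +-<-+suc : ∀ a n → a + + n < a + + suc n
  +-<-+suc a n = +-monoʳ-< a (+<+ (ℕₚ.n<1+n n))

  +suc≰+ : ∀ a n → ¬ (a + + suc n ≤ a + + n)
  +suc≰+ a n = <⇒≱ (+-<-+suc a n)

  ≤+⇒≤+suc : ∀ a n {y} → y ≤ a + + n → y ≤ a + + suc n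
  ≤+⇒≤+suc a n y≤ = ≤-trans y≤ (<⇒≤ (+-<-+suc a n))

  ≤+suc⇒≡⊎≤+ : ∀ a n {y} → y ≤ a + + suc n → y ≡ a + + suc n ⊎ y ≤ a + + n
  ≤+suc⇒≡⊎≤+ a n {y} y≤ with ≤⇒∃ y≤
  ... | zero  , eq = inj₁ (sym (trans eq (+-identityʳ y)))
  ... | suc k , eq = inj₂ (≡+⇒≤ k (∙-cancelˡ (+ 1) _ _ (begin
    + 1 + (a + + n)   ≡⟨ sym (+suc≡1++ a n) ⟩
    a + + suc n       ≡⟨ eq ⟩
    y + + suc k       ≡⟨ +suc≡1++ y k ⟩
    + 1 + (y + + k)   ∎)))
    where open ≡-Reasoning

  +-cancelˡ-≤ : ∀ c {a b} → c + a ≤ c + b → a ≤ b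
  +-cancelˡ-≤ c {a} {b} h = subst₂ _≤_ (-c+[c+a]≡a c a) (-c+[c+a]≡a c b) (+-monoʳ-≤ (- c) h)
    where
    -c+[c+a]≡a : ∀ c a → - c + (c + a) ≡ a
    -c+[c+a]≡a = solve-∀

  i+[1+k]≡[i+k]+1 : ∀ i k → i + (+ 1 + k) ≡ (i + k) + + 1
  i+[1+k]≡[i+k]+1 = solve-∀

  i-1+1≡i : ∀ i → i - + 1 + + 1 ≡ i
  i-1+1≡i = solve-∀

  i+1-1≡i : ∀ i → i + + 1 - + 1 ≡ i
  i+1-1≡i = solve-∀

  i+0*e≡i : ∀ i e → i + + 0 * e ≡ i
  i+0*e≡i = solve-∀

  -- Windows and counting

  InWindow : ℤ → ℕ → ℤ → Set
  InWindow a n x = a < x × x ≤ a + + n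

  top∈window : ∀ a n → InWindow a (suc n) (a + + suc n)
  top∈window a n = ≡+suc⇒< n refl , ≤-refl

  top∉window : ∀ {a n} → ¬ InWindow a n (a + + suc n)
  top∉window {a} {n} (_ , top≤) = +suc≰+ a n top≤

  window-weaken : ∀ {a n y} → InWindow a n y → InWindow a (suc n) y
  window-weaken {a} {n} (a<y , y≤) = a<y , ≤+⇒≤+suc a n y≤

  window-empty : ∀ {a y} → ¬ InWindow a 0 y
  window-empty {a} (a<y , y≤) = <-irrefl refl (<-≤-trans a<y (≤-trans y≤ (≤-reflexive (+-identityʳ a))))

  window-split : ∀ {a n y} → InWindow a (suc n) y → y ≡ a + + suc n ⊎ InWindow a n y
  window-split {a} {n} (a<y , y≤) with ≤+suc⇒≡⊎≤+ a n y≤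
  ... | inj₁ y≡top = inj₁ y≡top
  ... | inj₂ y≤′   = inj₂ (a<y , y≤′)

  indicator : ∀ {A : Set} → Dec A → ℕ
  indicator (yes _) = 1
  indicator (no _)  = 0

  weighted : ∀ {A : Set} → ℤ → Dec A → ℤ
  weighted x (yes _) = x
  weighted x (no _)  = + 0

  indicator-cong : ∀ {A B : Set} (A? : Dec A) (B? : Dec B) → (A → B) → (B → A) →
                   indicator A? ≡ indicator B? × (∀ x → weighted x A? ≡ weighted x B?)
  indicator-cong (yes _) (yes _) _   _   = refl , λ _ → refl
  indicator-cong (yes a) (no ¬b) A→B _   = ⊥-elim (¬b (A→B a))
  indicator-cong (no ¬a) (yes b) _   B→A = ⊥-elim (¬a (B→A b))
  indicator-cong (no _)  (no _)  _   _   = refl , λ _ → refl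

  indicator-mono : ∀ {A B : Set} (A? : Dec A) (B? : Dec B) → (A → B) → indicator A? ℕ.≤ indicator B?
  indicator-mono (yes _) (yes _) _   = ℕₚ.≤-refl
  indicator-mono (yes a) (no ¬b) A→B = ⊥-elim (¬b (A→B a))
  indicator-mono (no _)  _       _   = z≤n

  module _ {P : Subset} (P? : Decidable P) where

    count : ℤ → ℕ → ℕ
    count a zero    = 0
    count a (suc n) = count a n ℕ.+ indicator (P? (a + + suc n))

    weight : ℤ → ℕ → ℤ
    weight a zero    = + 0
    weight a (suc n) = weight a n + weighted (a + + suc n) (P? (a + + suc n))

  +-assoc-suc : ∀ a m n → (a + + m) + + suc n ≡ a + + suc (m ℕ.+ n)
  +-assoc-suc a m n = trans (+-assoc a (+ m) (+ suc n)) (cong (λ k → a + + k) (ℕₚ.+-suc m n))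

  module _ {P : Subset} (P? : Decidable P) (a : ℤ) (n : ℕ) where

    count-suc-∉ : ¬ P (a + + suc n) → count P? a (suc n) ≡ count P? a n
    count-suc-∉ ¬Pt with P? (a + + suc n)
    ... | yes Pt = ⊥-elim (¬Pt Pt)
    ... | no _   = ℕₚ.+-identityʳ _

    count-suc-∈ : P (a + + suc n) → count P? a (suc n) ≡ suc (count P? a n)
    count-suc-∈ Pt with P? (a + + suc n)
    ... | yes _  = ℕₚ.+-comm _ 1
    ... | no ¬Pt = ⊥-elim (¬Pt Pt)

  triangular : ℕ → ℕ
  triangular zero    = 0
  triangular (suc n) = triangular n ℕ.+ suc n

  triangular*2 : ∀ n → triangular n ℕ.* 2 ≡ n ℕ.* suc n
  triangular*2 zero    = refl
  triangular*2 (suc n) = begin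
    (triangular n ℕ.+ suc n) ℕ.* 2         ≡⟨ ℕₚ.*-distribʳ-+ 2 (triangular n) (suc n) ⟩
    triangular n ℕ.* 2 ℕ.+ suc n ℕ.* 2     ≡⟨ cong (ℕ._+ suc n ℕ.* 2) (triangular*2 n) ⟩
    n ℕ.* suc n ℕ.+ suc n ℕ.* 2           ≡⟨ regroup n ⟩
    suc n ℕ.* suc (suc n)                  ∎
    where
    open ≡-Reasoning
    regroup : ∀ n → n ℕ.* suc n ℕ.+ suc n ℕ.* 2 ≡ suc n ℕ.* suc (suc n)
    regroup = ℕ-Solver.solve-∀

  triangular≡ : ∀ n → triangular n ≡ (n ℕ.* suc n) ℕ./ 2
  triangular≡ n = trans (sym (m*n/n≡m (triangular n) 2)) (cong (ℕ._/ 2) (triangular*2 n))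

  module _ {P : Subset} (P? : Decidable P) where

    count-weight-full : ∀ a n → (∀ x → InWindow a n x → P x) →
                        count P? a n ≡ n × weight P? a n ≡ + n * a + + triangular n
    count-weight-full a zero    _    = refl , sym (0*a+0≡0 a)
      where
      0*a+0≡0 : ∀ a → + 0 * a + + 0 ≡ + 0
      0*a+0≡0 = solve-∀
    count-weight-full a (suc n) full with P? (a + + suc n) | count-weight-full a n (λ x → full x ∘ window-weaken)
    ... | no ¬top | _ = ⊥-elim (¬top (full _ (top∈window a n)))
    ... | yes _   | c≡n , w≡ = trans (cong (ℕ._+ 1) c≡n) (ℕₚ.+-comm n 1) ,
                               trans (cong (_+ (a + + suc n)) w≡) (step a (+ n) (+ triangular n))
      where
      step : ∀ a n t → (n * a + t) + (a + (+ 1 + n)) ≡ (+ 1 + n) * a + (t + (+ 1 + n))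
      step = solve-∀

    count-weight-empty : ∀ a n → (∀ x → InWindow a n x → ¬ P x) → count P? a n ≡ 0 × weight P? a n ≡ + 0
    count-weight-empty a zero    _     = refl , refl
    count-weight-empty a (suc n) empty with P? (a + + suc n) | count-weight-empty a n (λ x → empty x ∘ window-weaken)
    ... | yes top | _ = ⊥-elim (empty _ (top∈window a n) top)
    ... | no _    | c≡0 , w≡0 = cong (ℕ._+ 0) c≡0 , cong (_+ + 0) w≡0

    count-weight-split : ∀ a m n → count P? a (m ℕ.+ n) ≡ count P? a m ℕ.+ count P? (a + + m) n
                                  × weight P? a (m ℕ.+ n) ≡ weight P? a m + weight P? (a + + m) n
    count-weight-split a m zero rewrite ℕₚ.+-identityʳ m = sym (ℕₚ.+-identityʳ _) , sym (+-identityʳ _)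
    count-weight-split a m (suc n) with count-weight-split a m n
    ... | c≡ , w≡ rewrite ℕₚ.+-suc m n | sym (+-assoc-suc a m n) =
      trans (cong (ℕ._+ indicator (P? t)) c≡) (ℕₚ.+-assoc (count P? a m) _ _) ,
      trans (cong (_+ weighted t (P? t)) w≡) (+-assoc (weight P? a m) _ _)
      where
      t : ℤ
      t = (a + + m) + + suc n

  module _ {P Q : Subset} (P? : Decidable P) (Q? : Decidable Q) where

    count-weight-cong : ∀ a n → (∀ x → InWindow a n x → P x → Q x) → (∀ x → InWindow a n x → Q x → P x) →
                        count P? a n ≡ count Q? a n × weight P? a n ≡ weight Q? a n
    count-weight-cong a zero    _   _   = refl , refl
    count-weight-cong a (suc n) P→Q Q→P
      with count-weight-cong a n (λ x → P→Q x ∘ window-weaken) (λ x → Q→P x ∘ window-weaken)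
    ... | c≡ , w≡ = cong₂ ℕ._+_ c≡ (proj₁ top≡) , cong₂ _+_ w≡ (proj₂ top≡ t)
      where
      t : ℤ
      t = a + + suc n
      top≡ : indicator (P? t) ≡ indicator (Q? t) × (∀ x → weighted x (P? t) ≡ weighted x (Q? t))
      top≡ = indicator-cong (P? t) (Q? t) (P→Q t (top∈window a n)) (Q→P t (top∈window a n))

    count-mono : ∀ a n → P ⊆ Q → count P? a n ℕ.≤ count Q? a n
    count-mono a zero    _   = z≤n
    count-mono a (suc n) P⊆Q = ℕₚ.+-mono-≤ (count-mono a n P⊆Q) (indicator-mono (P? _) (Q? _) (P⊆Q _))

    count-< : ∀ a n {y} → P ⊆ Q → InWindow a n y → Q y → ¬ P y → count P? a n ℕ.< count Q? a n
    count-< a zero    P⊆Q y∈ _  _  = ⊥-elim (window-empty y∈)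
    count-< a (suc n) P⊆Q y∈ Qy ¬Py with window-split y∈
    ... | inj₂ y∈′ = ℕₚ.+-mono-<-≤ (count-< a n P⊆Q y∈′ Qy ¬Py) (indicator-mono (P? _) (Q? _) (P⊆Q _))
    ... | inj₁ refl with P? (a + + suc n) | Q? (a + + suc n)
    ...   | yes Py | _     = ⊥-elim (¬Py Py)
    ...   | no _   | no ¬Q = ⊥-elim (¬Q Qy)
    ...   | no _   | yes _ = ℕₚ.+-mono-≤-< (count-mono a n P⊆Q) ℕₚ.≤-refl

    private
      ∃-weaken : ∀ {a n} → ∃[ y ] InWindow a n y × Q y × ¬ P y → ∃[ y ] InWindow a (suc n) y × Q y × ¬ P y
      ∃-weaken (y , y∈ , Qy , ¬Py) = y , window-weaken y∈ , Qy , ¬Py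

    count-<⇒∃ : ∀ a n → count P? a n ℕ.< count Q? a n → ∃[ y ] InWindow a n y × Q y × ¬ P y
    count-<⇒∃ a zero ()
    count-<⇒∃ a (suc n) lt with P? (a + + suc n) | Q? (a + + suc n)
    ... | no ¬Py | yes Qy = a + + suc n , top∈window a n , Qy , ¬Py
    ... | yes _  | yes _  = ∃-weaken (count-<⇒∃ a n (ℕₚ.+-cancelʳ-< 1 _ _ lt))
    ... | no _   | no _   = ∃-weaken (count-<⇒∃ a n (ℕₚ.+-cancelʳ-< 0 _ _ lt))
    ... | yes _  | no _   = ∃-weaken (count-<⇒∃ a n
            (ℕₚ.≤-<-trans (ℕₚ.m≤m+n _ 1) (ℕₚ.<-≤-trans lt (ℕₚ.≤-reflexive (ℕₚ.+-identityʳ _)))))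

    count-weight-insert : ∀ a n {y} → P ⊆ Q → (∀ x → Q x → P x ⊎ x ≡ y) → InWindow a n y → Q y → ¬ P y →
                          count Q? a n ≡ suc (count P? a n) × weight Q? a n ≡ weight P? a n + y
    count-weight-insert a zero    _   _      y∈ _  _   = ⊥-elim (window-empty y∈)
    count-weight-insert a (suc n) {y} P⊆Q Q⊆P∪y y∈ Qy ¬Py with window-split y∈
    ... | inj₂ y∈′ with count-weight-insert a n P⊆Q Q⊆P∪y y∈′ Qy ¬Py
    ...   | c≡ , w≡ = cong₂ ℕ._+_ c≡ (proj₁ top≡) ,
                      trans (cong₂ _+_ w≡ (proj₂ top≡ t)) (+-swapʳ (weight P? a n) y (weighted t (P? t)))
      where
      t : ℤ
      t = a + + suc n
      Qt→Pt : Q t → P t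
      Qt→Pt Qt with Q⊆P∪y t Qt
      ... | inj₁ Pt  = Pt
      ... | inj₂ t≡y = ⊥-elim (top∉window (subst (InWindow a n) (sym t≡y) y∈′))
      top≡ : indicator (Q? t) ≡ indicator (P? t) × (∀ x → weighted x (Q? t) ≡ weighted x (P? t))
      top≡ = indicator-cong (Q? t) (P? t) Qt→Pt (P⊆Q t)
      +-swapʳ : ∀ a b c → a + b + c ≡ a + c + b
      +-swapʳ = solve-∀
    count-weight-insert a (suc n) {y} P⊆Q Q⊆P∪y y∈ Qy ¬Py | inj₁ refl
      with count-weight-cong a n (λ x _ → P⊆Q x) Q→P | Q? (a + + suc n) | P? (a + + suc n)
      where
      Q→P : ∀ x → InWindow a n x → Q x → P x
      Q→P x x∈ Qx with Q⊆P∪y x Qx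
      ... | inj₁ Px  = Px
      ... | inj₂ refl = ⊥-elim (top∉window x∈)
    ... | _ , _     | no ¬Qy | _     = ⊥-elim (¬Qy Qy)
    ... | _ , _     | yes _  | yes Py = ⊥-elim (¬Py Py)
    ... | c≡ , w≡   | yes _  | no _  =
      trans (cong (ℕ._+ 1) (sym c≡)) (trans (ℕₚ.+-comm _ 1) (cong suc (sym (ℕₚ.+-identityʳ _)))) ,
      cong (_+ y) (trans (sym w≡) (sym (+-identityʳ _)))

  module _ {P Q : Subset} (P? : Decidable P) (Q? : Decidable Q) (e : ℕ)
           (Q↔P : ∀ x → Q (x + + e) → P x) (P↔Q : ∀ x → P x → Q (x + + e)) where

    count-weight-shift : ∀ a n → count Q? (a + + e) n ≡ count P? a n
                               × weight Q? (a + + e) n ≡ weight P? a n + + e * + count P? a n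
    count-weight-shift a zero = refl , sym (0+e*0≡0 (+ e))
      where
      0+e*0≡0 : ∀ e → + 0 + e * + 0 ≡ + 0
      0+e*0≡0 = solve-∀
    count-weight-shift a (suc n) with count-weight-shift a n
    ... | c≡ , w≡ = cong₂ ℕ._+_ c≡ (proj₁ (indicator-cong (Q? t) (P? s) Qt→Ps Ps→Qt)) ,
                    trans (cong₂ _+_ w≡ (top-weight (Q? t) (P? s) Qt→Ps Ps→Qt))
                          (regroup (weight P? a n) (weighted s (P? s)) (+ count P? a n) (+ indicator (P? s)) (+ e))
      where
      s t : ℤ
      s = a + + suc n
      t = (a + + e) + + suc n
      t≡s+e : t ≡ s + + e
      t≡s+e = [a+e]+s≡[a+s]+e a (+ e) (+ suc n)
        where
        [a+e]+s≡[a+s]+e : ∀ a e s → (a + e) + s ≡ (a + s) + e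
        [a+e]+s≡[a+s]+e = solve-∀
      Qt→Ps : Q t → P s
      Qt→Ps = Q↔P s ∘ subst Q t≡s+e
      Ps→Qt : P s → Q t
      Ps→Qt = subst Q (sym t≡s+e) ∘ P↔Q s
      top-weight : ∀ {A B : Set} (A? : Dec A) (B? : Dec B) → (A → B) → (B → A) →
                   weighted t A? ≡ weighted s B? + + e * + indicator B?
      top-weight (yes _) (yes _) _ _ = trans t≡s+e (cong (_+_ s) (sym (*-identityʳ (+ e))))
      top-weight (yes a) (no ¬b) f _ = ⊥-elim (¬b (f a))
      top-weight (no ¬a) (yes b) _ g = ⊥-elim (¬a (g b))
      top-weight (no _)  (no _)  _ _ = sym (cong (_+_ (+ 0)) (*-zeroʳ (+ e)))
      regroup : ∀ w u c i e → (w + e * c) + (u + e * i) ≡ (w + u) + e * (c + i)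
      regroup = solve-∀

  count-suc⇒unique : ∀ {P Q : Subset} (P? : Decidable P) (Q? : Decidable Q) a n → P ⊆ Q →
                     count Q? a n ≡ suc (count P? a n) →
                     ∀ {y z} → InWindow a n y → Q y → ¬ P y → InWindow a n z → Q z → ¬ P z → y ≡ z
  count-suc⇒unique {P} {Q} P? Q? a n P⊆Q c≡ {y} {z} y∈ Qy ¬Py z∈ Qz ¬Pz with y ≟ z
  ... | yes y≡z = y≡z
  ... | no y≢z  = ⊥-elim (ℕₚ.<-irrefl refl (ℕₚ.≤-trans (ℕₚ.≤-trans (s≤s P<P∪y) P∪y<Q) (ℕₚ.≤-reflexive c≡)))
    where
    P∪y : Subset
    P∪y x = P x ⊎ x ≡ y
    P∪y? : Decidable P∪y
    P∪y? x = P? x ⊎-dec (x ≟ y)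
    P<P∪y : count P? a n ℕ.< count P∪y? a n
    P<P∪y = count-< P? P∪y? a n (λ _ → inj₁) y∈ (inj₂ refl) ¬Py
    P∪y<Q : count P∪y? a n ℕ.< count Q? a n
    P∪y<Q = count-< P∪y? Q? a n (λ x → [ P⊆Q x , (λ { refl → Qy }) ]) z∈ Qz [ ¬Pz , (λ z≡y → y≢z (sym z≡y)) ]

  +k+1≡+[1+k] : ∀ k → + k + + 1 ≡ + suc k
  +k+1≡+[1+k] k = cong +_ (ℕₚ.+-comm k 1)

  -- Flags

  Below : (ℤ → ℤ) → ℤ → Subset
  Below w i x = ∃[ j ] j ≤ i × w j ≡ x

  -- Modelled on B i = w((-∞, i]), the abacus of w · ∅ᵢ: each step adds exactly the bead w (i + 1).
  module Flag (B : ℤ → Subset) (B? : ∀ i → Decidable (B i)) (w : ℤ → ℤ) (K : ℕ)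
    (B-step : ∀ i → B i ⊆ B (i + + 1))
    (w∈B    : ∀ i → B i (w i))
    (w∉B    : ∀ i → ¬ B i (w (i + + 1)))
    (B-new  : ∀ i x → B (i + + 1) x → B i x ⊎ x ≡ w (i + + 1))
    (B-low  : ∀ i x → x + + K ≤ i → B i x)
    (B-high : ∀ i x → i + + K < x → ¬ B i x)
    where

    B-mono+ : ∀ i k → B i ⊆ B (i + + k)
    B-mono+ i zero    x Bix = subst (λ j → B j x) (sym (+-identityʳ i)) Bix
    B-mono+ i (suc k) x Bix = subst (λ j → B j x) (sym (i+[1+k]≡[i+k]+1 i (+ k))) (B-step (i + + k) x (B-mono+ i k x Bix))

    B-mono : ∀ {i j} → i ≤ j → B i ⊆ B j
    B-mono i≤j x Bix with ≤⇒∃ i≤j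
    ... | k , refl = B-mono+ _ k x Bix

    B-step-ℕ : ∀ k → B (+ k) ⊆ B (+ suc k)
    B-step-ℕ k x = subst (λ j → B j x) (+k+1≡+[1+k] k) ∘ B-step (+ k) x

    image⊆B : ∀ {i j} → j ≤ i → B i (w j)
    image⊆B j≤i = B-mono j≤i _ (w∈B _)

    private
      w-<⇒≢ : ∀ {i j} → i < j → w i ≢ w j
      w-<⇒≢ {i} i<j wi≡wj with <⇒∃ i<j
      ... | k , refl = w∉B (i + + k) (subst (B (i + + k)) (trans wi≡wj (cong w (i+[1+k]≡[i+k]+1 i (+ k))))
                                          (B-mono+ i k (w i) (w∈B i)))

    w-injective : ∀ {i j} → w i ≡ w j → i ≡ j
    w-injective {i} {j} wi≡wj with <-cmp i j
    ... | tri< i<j _ _ = ⊥-elim (w-<⇒≢ i<j wi≡wj)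
    ... | tri≈ _ i≡j _ = i≡j
    ... | tri> _ _ j<i = ⊥-elim (w-<⇒≢ j<i (sym wi≡wj))

    private
      descend : ∀ t i x → B i x → ¬ B (i - + t) x → ∃[ j ] j ≤ i × w j ≡ x
      descend zero    i x Bix ¬B = ⊥-elim (¬B (subst (λ j → B j x) (sym (+-identityʳ i)) Bix))
      descend (suc t) i x Bix ¬B with B? (i - + 1) x
      ... | yes B′ with descend t (i - + 1) x B′ (¬B ∘ subst (λ j → B j x) (i-1-t≡i-[1+t] i (+ t)))
        where
        i-1-t≡i-[1+t] : ∀ i t → i - + 1 - t ≡ i - (+ 1 + t)
        i-1-t≡i-[1+t] = solve-∀
      ...   | j , j≤ , wj≡x = j , ≤-trans j≤ (i-j≤i i (+ 1)) , wj≡x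
      descend (suc t) i x Bix ¬B | no ¬B′ with B-new (i - + 1) x (subst (λ j → B j x) (sym (i-1+1≡i i)) Bix)
      ... | inj₁ B′   = ⊥-elim (¬B′ B′)
      ... | inj₂ x≡w = i , ≤-refl , sym (trans x≡w (cong w (i-1+1≡i i)))

    B⊆image : ∀ i → B i ⊆ Below w i
    B⊆image i x Bix with ≤⇒∃ (≮⇒≥ (λ i+K<x → B-high i x i+K<x Bix))
    ... | d , i+K≡x+d = descend (suc d) i x Bix (B-high (i - + suc d) x (≡+suc⇒< 0 (below i (+ K) (+ d) x i+K≡x+d)))
      where
      below : ∀ i K d x → i + K ≡ x + d → x ≡ (i - (+ 1 + d) + K) + + 1
      below i K d x i+K≡x+d = begin
        x                         ≡⟨ x≡x+d-d x d ⟩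
        x + d - d                 ≡⟨ cong (_- d) (sym i+K≡x+d) ⟩
        i + K - d                 ≡⟨ regroup i K d ⟩
        (i - (+ 1 + d) + K) + + 1 ∎
        where
        open ≡-Reasoning
        x≡x+d-d : ∀ x d → x ≡ x + d - d
        x≡x+d-d = solve-∀
        regroup : ∀ i K d → i + K - d ≡ (i - (+ 1 + d) + K) + + 1
        regroup = solve-∀

    B≐Below : ∀ i → B i ≐ Below w i
    B≐Below i = B⊆image i , λ { x (j , j≤i , refl) → image⊆B j≤i }

    w-surjective : ∀ x → ∃[ j ] w j ≡ x
    w-surjective x with B⊆image (x + + K) x (B-low (x + + K) x ≤-refl)
    ... | j , _ , wj≡x = j , wj≡x

    module FlagSum (e : ℕ) (B-shift   : ∀ x → B (+ 0) x → B (+ e) (x + + e))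
                           (B-unshift : ∀ x → B (+ e) (x + + e) → B (+ 0) x) where

      a : ℤ
      a = - + K - + e

      L : ℤ
      L = a + + e

      N : ℕ
      N = (K ℕ.+ K) ℕ.+ e

      charge₀ : ℤ
      charge₀ = L + + count (B? (+ 0)) L N

      ≤L⇒B : ∀ k x → x ≤ L → B (+ k) x
      ≤L⇒B k x x≤L =
        B-low (+ k) x (≤-trans (+-monoˡ-≤ (+ K) x≤L) (≤-trans (≤-reflexive (L+K≡0 (+ K) (+ e))) (+≤+ z≤n)))
        where
        L+K≡0 : ∀ K e → (- K - e) + e + K ≡ + 0
        L+K≡0 = solve-∀

      >L+N⇒∉B : ∀ k → k ℕ.≤ e → ∀ x → L + + N < x → ¬ B (+ k) x
      >L+N⇒∉B k k≤e x L+N<x = B-high (+ k) x (≤-<-trans (≤-trans (+-monoˡ-≤ (+ K) (+≤+ k≤e))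
                                                             (≤-reflexive (e+K≡L+N (+ K) (+ e)))) L+N<x)
        where
        e+K≡L+N : ∀ K e → e + K ≡ ((- K - e) + e) + ((K + K) + e)
        e+K≡L+N = solve-∀

      private
        B-new′ : ∀ k x → B (+ suc k) x → B (+ k) x ⊎ x ≡ w (+ suc k)
        B-new′ k x Bx with B-new (+ k) x (subst (λ j → B j x) (sym (+k+1≡+[1+k] k)) Bx)
        ... | inj₁ B′  = inj₁ B′
        ... | inj₂ x≡w = inj₂ (trans x≡w (cong w (+k+1≡+[1+k] k)))

        w∉B′ : ∀ k → ¬ B (+ k) (w (+ suc k))
        w∉B′ k = w∉B (+ k) ∘ subst (B (+ k)) (cong w (sym (+k+1≡+[1+k] k)))

        w∈window : ∀ k → k ℕ.< e → InWindow L N (w (+ suc k))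
        w∈window k k<e = ≰⇒> (λ w≤L → w∉B′ k (≤L⇒B k _ w≤L)) ,
                         ≮⇒≥ (λ L+N<w → >L+N⇒∉B (suc k) k<e _ L+N<w (w∈B _))

      count-weight-walk : ∀ k → k ℕ.≤ e → count (B? (+ k)) L N ≡ k ℕ.+ count (B? (+ 0)) L N
                                        × weight (B? (+ k)) L N ≡ weight (B? (+ 0)) L N + sumW w k
      count-weight-walk zero    _   = refl , sym (+-identityʳ _)
      count-weight-walk (suc k) k<e
        with count-weight-walk k (ℕₚ.<⇒≤ k<e)
           | count-weight-insert (B? (+ k)) (B? (+ suc k)) L N (B-step-ℕ k) (B-new′ k) (w∈window k k<e) (w∈B _) (w∉B′ k)
      ... | c≡ , w≡ | c′≡ , w′≡ = trans c′≡ (cong suc c≡) ,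
                                  trans w′≡ (trans (cong (_+ w (+ suc k)) w≡) (+-assoc (weight (B? (+ 0)) L N) (sumW w k) _))

      charge-walk : ∀ k → k ℕ.≤ e → L + + count (B? (+ k)) L N ≡ + k + charge₀
      charge-walk k k≤e = trans (cong (λ c → L + + c) (proj₁ (count-weight-walk k k≤e)))
                                (L+[k+c]≡k+[L+c] L (+ k) (+ count (B? (+ 0)) L N))
        where
        L+[k+c]≡k+[L+c] : ∀ L k c → L + (k + c) ≡ k + (L + c)
        L+[k+c]≡k+[L+c] = solve-∀

      -- B (+ e) is both B (+ 0) shifted by e and B (+ 0) with the beads w 1, …, w e added;
      -- compare the two expressions for the sum of its beads in the window.
      sumW≡ : sumW w e ≡ + e * charge₀ + + triangular e
      sumW≡ = ∙-cancelˡ (W′ + + 0) _ _ (begin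
        (W′ + + 0) + sumW w e                            ≡⟨ cong (_+ sumW w e) (sym (proj₂ splitL)) ⟩
        weight B₀? L N + sumW w e                        ≡⟨ sym (proj₂ (count-weight-walk e ℕₚ.≤-refl)) ⟩
        weight (B? (+ e)) L N                            ≡⟨ proj₂ shifted ⟩
        weight B₀? a N + + e * + count B₀? a N           ≡⟨ cong₂ (λ s c → s + + e * + c) (proj₂ splitA) (proj₁ splitA) ⟩
        (+ e * a + + triangular e + W′) + + e * (+ e + + C′) ≡⟨ regroup W′ a (+ e) (+ C′) (+ triangular e) ⟩
        (W′ + + 0) + (+ e * (L + + (C′ ℕ.+ 0)) + + triangular e)
                                                         ≡⟨ cong (λ c → (W′ + + 0) + (+ e * (L + + c) + + triangular e))
                                                                 (sym (proj₁ splitL)) ⟩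
        (W′ + + 0) + (+ e * charge₀ + + triangular e)    ∎)
        where
        open ≡-Reasoning
        B₀? : Decidable (B (+ 0))
        B₀? = B? (+ 0)
        n′ C′ : ℕ
        n′ = K ℕ.+ K
        C′ = count B₀? L n′
        W′ : ℤ
        W′ = weight B₀? L n′
        empty : count B₀? (L + + n′) e ≡ 0 × weight B₀? (L + + n′) e ≡ + 0
        empty = count-weight-empty B₀? (L + + n′) e
                  (λ x x∈ → B-high (+ 0) x (≤-<-trans (≤-reflexive (K≡L+2K (+ K) (+ e))) (proj₁ x∈)))
          where
          K≡L+2K : ∀ K e → + 0 + K ≡ ((- K - e) + e) + (K + K)
          K≡L+2K = solve-∀
        full : count B₀? a e ≡ e × weight B₀? a e ≡ + e * a + + triangular e
        full = count-weight-full B₀? a e (λ x x∈ → ≤L⇒B 0 x (proj₂ x∈))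
        splitL : count B₀? L N ≡ C′ ℕ.+ 0 × weight B₀? L N ≡ W′ + + 0
        splitL with count-weight-split B₀? L n′ e
        ... | c≡ , w≡ = trans c≡ (cong (C′ ℕ.+_) (proj₁ empty)) , trans w≡ (cong (_+_ W′) (proj₂ empty))
        splitA : count B₀? a N ≡ e ℕ.+ C′ × weight B₀? a N ≡ + e * a + + triangular e + W′
        splitA rewrite ℕₚ.+-comm n′ e with count-weight-split B₀? a e n′
        ... | c≡ , w≡ = trans c≡ (cong (ℕ._+ C′) (proj₁ full)) , trans w≡ (cong (_+ W′) (proj₂ full))
        shifted : count (B? (+ e)) L N ≡ count B₀? a N × weight (B? (+ e)) L N ≡ weight B₀? a N + + e * + count B₀? a N
        shifted = count-weight-shift B₀? (B? (+ e)) e B-unshift B-shift a N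
        regroup : ∀ W a e c t → (e * a + t + W) + e * (e + c) ≡ (W + + 0) + (e * ((a + e) + (c + + 0)) + t)
        regroup = solve-∀

  -- Abaci

  listAbacus : ℤ → List ℕ → Subset
  listAbacus c l x = ∃[ i ] x ≡ ((+ at l i - + suc i) + c) + + 1

  -- The abacus of the c-charged partition (m ∷ l) has the bead m + c on top of the abacus of the
  -- (c - 1)-charged partition l.
  Beads : ℤ → List ℕ → Subset
  Beads c []      x = x ≤ c
  Beads c (m ∷ l) x = x ≡ + m + c ⊎ Beads (c - + 1) l x

  private
    [m-1+c]+1≡m+c : ∀ m c → ((m - + 1) + c) + + 1 ≡ m + c
    [m-1+c]+1≡m+c = solve-∀

    bead-suc : ∀ a i c → (a - (+ 1 + (+ 1 + i)) + c) + + 1 ≡ (a - (+ 1 + i) + (c - + 1)) + + 1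
    bead-suc = solve-∀

    c-[1+n]≡c-1-n : ∀ c n → c - (+ 1 + n) ≡ (c - + 1) - n
    c-[1+n]≡c-1-n = solve-∀

  listAbacus⇒Beads : ∀ c l {x} → listAbacus c l x → Beads c l x
  listAbacus⇒Beads c []      (i , refl)     = ≡+⇒≤ i ([-[1+i]+c]+1+i≡c (+ i) c)
    where
    [-[1+i]+c]+1+i≡c : ∀ i c → c ≡ (((+ 0 - (+ 1 + i)) + c) + + 1) + i
    [-[1+i]+c]+1+i≡c = solve-∀
  listAbacus⇒Beads c (m ∷ l) (zero  , refl) = inj₁ ([m-1+c]+1≡m+c (+ m) c)
  listAbacus⇒Beads c (m ∷ l) (suc i , refl) = inj₂ (listAbacus⇒Beads (c - + 1) l (i , bead-suc (+ at l i) (+ i) c))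

  Beads⇒listAbacus : ∀ c l {x} → Beads c l x → listAbacus c l x
  Beads⇒listAbacus c []      {x} x≤c with ≤⇒∃ x≤c
  ... | i , refl = i , x≡[-[1+i]+[x+i]]+1 x (+ i)
    where
    x≡[-[1+i]+[x+i]]+1 : ∀ x i → x ≡ ((+ 0 - (+ 1 + i)) + (x + i)) + + 1
    x≡[-[1+i]+[x+i]]+1 = solve-∀
  Beads⇒listAbacus c (m ∷ l) (inj₁ refl) = zero , sym ([m-1+c]+1≡m+c (+ m) c)
  Beads⇒listAbacus c (m ∷ l) (inj₂ x∈) with Beads⇒listAbacus (c - + 1) l x∈
  ... | i , refl = suc i , sym (bead-suc (+ at l i) (+ i) c)

  Beads? : ∀ c l → Decidable (Beads c l)
  Beads? c []      x = x ≤? c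
  Beads? c (m ∷ l) x = (x ≟ + m + c) ⊎-dec Beads? (c - + 1) l x

  IsPartition : List ℕ → Set
  IsPartition l = Linked ℕ._≥_ l × All (0 ℕ.<_) l

  private
    tail-isPartition : ∀ {m l} → IsPartition (m ∷ l) → IsPartition l
    tail-isPartition (m≥l , _ All.∷ l>0) = Linked.tail m≥l , l>0

    head-≥ : ∀ {m l} → IsPartition (m ∷ l) → at l 0 ℕ.≤ m
    head-≥ {l = []}    _               = z≤n
    head-≥ {l = _ ∷ _} (m≥ Linked.∷ _ , _) = m≥

    head->0 : ∀ {m l} → IsPartition (m ∷ l) → 0 ℕ.< m
    head->0 (_ , m>0 All.∷ _) = m>0

  Beads-low : ∀ c l x → x ≤ c - + length l → Beads c l x
  Beads-low c []      x x≤ = ≤-trans x≤ (≤-reflexive (+-identityʳ c))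
  Beads-low c (m ∷ l) x x≤ = inj₂ (Beads-low (c - + 1) l x (≤-trans x≤ (≤-reflexive (c-[1+n]≡c-1-n c (+ length l)))))

  second<top : ∀ c m l → IsPartition (m ∷ l) → (c - + 1) + + at l 0 < + m + c
  second<top c m l p = ≡+suc⇒< (m ℕ.∸ at l 0) (trans (cong (λ k → + k + c) (sym (ℕₚ.m+[n∸m]≡n (head-≥ p))))
                                                 (regroup c (+ at l 0) (+ (m ℕ.∸ at l 0))))
    where
    regroup : ∀ c h d → h + d + c ≡ ((c - + 1) + h) + (+ 1 + d)
    regroup = solve-∀

  Beads-high : ∀ c l x → IsPartition l → Beads c l x → x ≤ c + + at l 0
  Beads-high c []      x _ x≤c         = ≤-trans x≤c (≤-reflexive (sym (+-identityʳ c)))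
  Beads-high c (m ∷ l) x _ (inj₁ refl) = ≤-reflexive (+-comm (+ m) c)
  Beads-high c (m ∷ l) x p (inj₂ x∈)   = <⇒≤ (≤-<-trans (Beads-high (c - + 1) l x (tail-isPartition p) x∈)
                                              (<-≤-trans (second<top c m l p) (≤-reflexive (+-comm (+ m) c))))

  Beads-charge : ∀ c l L n → IsPartition l → L ≤ c - + length l → c + + at l 0 ≤ L + + n →
                 L + + count (Beads? c l) L n ≡ c
  Beads-charge c [] L n _ L≤c c≤L+n with ≤⇒∃ (≤-trans L≤c (≤-reflexive (+-identityʳ c)))
  ... | k , refl = cong (λ c → L + + c) (begin
    count below L n                                 ≡⟨ cong (count below L) (sym (ℕₚ.m+[n∸m]≡n k≤n)) ⟩
    count below L (k ℕ.+ (n ℕ.∸ k))                 ≡⟨ proj₁ (count-weight-split below L k (n ℕ.∸ k)) ⟩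
    count below L k ℕ.+ count below (L + + k) (n ℕ.∸ k) ≡⟨ cong₂ ℕ._+_ (proj₁ full) (proj₁ empty) ⟩
    k ℕ.+ 0                                         ≡⟨ ℕₚ.+-identityʳ k ⟩
    k                                               ∎)
    where
    open ≡-Reasoning
    below : Decidable (Beads (L + + k) [])
    below = Beads? (L + + k) []
    k≤n : k ℕ.≤ n
    k≤n = drop‿+≤+ (+-cancelˡ-≤ L (≤-trans (≤-reflexive (sym (+-identityʳ (L + + k)))) c≤L+n))
    full : count below L k ≡ k × weight below L k ≡ + k * L + + triangular k
    full = count-weight-full below L k (λ _ → proj₂)
    empty : count below (L + + k) (n ℕ.∸ k) ≡ 0 × weight below (L + + k) (n ℕ.∸ k) ≡ + 0
    empty = count-weight-empty below (L + + k) (n ℕ.∸ k) (λ _ x∈ x≤ → <-irrefl refl (<-≤-trans (proj₁ x∈) x≤))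
  Beads-charge c (m ∷ l) L n p L≤ c+m≤ = begin
    L + + count (Beads? c (m ∷ l)) L n                 ≡⟨ cong (λ k → L + + k) (proj₁ inserted) ⟩
    L + (+ 1 + + count (Beads? (c - + 1) l) L n)       ≡⟨ i+[1+k]≡[i+k]+1 L (+ count (Beads? (c - + 1) l) L n) ⟩
    L + + count (Beads? (c - + 1) l) L n + + 1         ≡⟨ cong (_+ + 1) tail-charge ⟩
    c - + 1 + + 1                                      ≡⟨ i-1+1≡i c ⟩
    c                                                  ∎
    where
    open ≡-Reasoning
    regroup : ∀ c n m → m + c ≡ (c - (+ 1 + n)) + (+ 1 + (n + m))
    regroup = solve-∀
    top : ℤ
    top = + m + c
    L<top : L < top
    L<top = ≤-<-trans L≤ (≡+suc⇒< (length l ℕ.+ m) (regroup c (+ length l) (+ m)))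
    tail-charge : L + + count (Beads? (c - + 1) l) L n ≡ c - + 1
    tail-charge = Beads-charge (c - + 1) l L n (tail-isPartition p) (≤-trans L≤ (≤-reflexive (c-[1+n]≡c-1-n c (+ length l))))
                    (≤-trans (<⇒≤ (second<top c m l p)) (≤-trans (≤-reflexive (+-comm (+ m) c)) c+m≤))
    top∉tail : ¬ Beads (c - + 1) l top
    top∉tail b = <-irrefl refl (≤-<-trans (Beads-high (c - + 1) l top (tail-isPartition p) b) (second<top c m l p))
    inserted : count (Beads? c (m ∷ l)) L n ≡ suc (count (Beads? (c - + 1) l) L n)
             × weight (Beads? c (m ∷ l)) L n ≡ weight (Beads? (c - + 1) l) L n + top
    inserted = count-weight-insert (Beads? (c - + 1) l) (Beads? c (m ∷ l)) L n (λ _ → inj₂) (λ _ → [ inj₂ , inj₁ ])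
                 (L<top , ≤-trans (≤-reflexive (+-comm (+ m) c)) c+m≤) (inj₁ refl) top∉tail

  module _ {P : Subset} (P? : Decidable P) (L : ℤ) (P-low : ∀ x → x ≤ L → P x) where

    record Scanned (j : ℕ) : Set where
      field
        c           : ℤ
        beads       : List ℕ
        isPartition : IsPartition beads
        c≡          : c ≡ L + + count P? L j
        sound       : ∀ x → Beads c beads x → P x × x ≤ L + + j
        complete    : ∀ x → P x → x ≤ L + + j → Beads c beads x
        top≤        : c + + at beads 0 ≤ L + + j

    private
      start : Scanned 0
      start = record
        { c = L ; beads = [] ; isPartition = Linked.[] , All.[] ; c≡ = sym (+-identityʳ L)
        ; sound = λ x x≤L → P-low x x≤L , ≤-trans x≤L (≤-reflexive (sym (+-identityʳ L)))
        ; complete = λ x _ x≤ → ≤-trans x≤ (≤-reflexive (+-identityʳ L))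
        ; top≤ = ≤-refl }

      skip : ∀ {j} → Scanned j → ¬ P (L + + suc j) → Scanned (suc j)
      skip {j} s ¬Pt = record
        { c = c ; beads = beads ; isPartition = isPartition
        ; c≡ = trans c≡ (cong (λ k → L + + k) (sym (count-suc-∉ P? L j ¬Pt)))
        ; sound = λ x b → proj₁ (sound x b) , ≤+⇒≤+suc L j (proj₂ (sound x b))
        ; complete = λ x Px x≤ → [ (λ { refl → ⊥-elim (¬Pt Px) }) , complete x Px ] (≤+suc⇒≡⊎≤+ L j x≤)
        ; top≤ = ≤+⇒≤+suc L j top≤ }
        where open Scanned s

      no-parts : ∀ c l → IsPartition l → c + + at l 0 ≤ c + + 0 → l ≡ []
      no-parts c []      _ _  = refl
      no-parts c (m ∷ l) p c+m≤c = ⊥-elim (<⇒≱ (+-monoʳ-< c (+<+ (head->0 p))) c+m≤c)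

      charge-suc : ∀ {j} (s : Scanned j) → P (L + + suc j) → Scanned.c s + + 1 ≡ L + + count P? L (suc j)
      charge-suc {j} s Pt = begin
        c + + 1                          ≡⟨ cong (_+ + 1) c≡ ⟩
        L + + count P? L j + + 1         ≡⟨ sym (i+[1+k]≡[i+k]+1 L (+ count P? L j)) ⟩
        L + + suc (count P? L j)         ≡⟨ cong (λ k → L + + k) (sym (count-suc-∈ P? L j Pt)) ⟩
        L + + count P? L (suc j)         ∎
        where
        open ≡-Reasoning
        open Scanned s

      take-empty : ∀ {j} (s : Scanned j) → P (L + + suc j) → L + + j ≡ Scanned.c s + + 0 → Scanned (suc j)
      take-empty {j} s Pt L+j≡c+0 = record
        { c = c + + 1 ; beads = [] ; isPartition = Linked.[] , All.[] ; c≡ = charge-suc s Pt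
        ; sound = sound′ ; complete = complete′ ; top≤ = ≤-reflexive (trans (+-identityʳ _) (sym t≡c+1)) }
        where
        open Scanned s
        beads≡[] : beads ≡ []
        beads≡[] = no-parts c beads isPartition (≤-trans top≤ (≤-reflexive L+j≡c+0))
        t≡c+1 : L + + suc j ≡ c + + 1
        t≡c+1 = trans (+suc≡1++ L j) (trans (+-comm (+ 1) (L + + j)) (cong (_+ + 1) (trans L+j≡c+0 (+-identityʳ c))))
        sound′ : ∀ x → x ≤ c + + 1 → P x × x ≤ L + + suc j
        sound′ x x≤ with ≤+suc⇒≡⊎≤+ c 0 x≤
        ... | inj₁ refl = subst P t≡c+1 Pt , ≤-reflexive (sym t≡c+1)
        ... | inj₂ x≤c  = proj₁ old , ≤+⇒≤+suc L j (proj₂ old)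
          where
          old : P x × x ≤ L + + j
          old = sound x (subst (λ l → Beads c l x) (sym beads≡[]) (≤-trans x≤c (≤-reflexive (+-identityʳ c))))
        complete′ : ∀ x → P x → x ≤ L + + suc j → x ≤ c + + 1
        complete′ x Px x≤ with ≤+suc⇒≡⊎≤+ L j x≤
        ... | inj₁ refl = ≤-reflexive t≡c+1
        ... | inj₂ x≤′  = ≤-trans (subst (λ l → Beads c l x) beads≡[] (complete x Px x≤′)) (i≤i+j c (+ 1))

      take-part : ∀ {j} (s : Scanned j) → P (L + + suc j) → ∀ k → L + + j ≡ Scanned.c s + + suc k → Scanned (suc j)
      take-part {j} s Pt k L+j≡c+k = record
        { c = c + + 1 ; beads = suc k ∷ beads ; isPartition = isPartition′ ; c≡ = charge-suc s Pt
        ; sound = sound′ ; complete = complete′ ; top≤ = ≤-reflexive (sym t≡top) }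
        where
        open Scanned s
        t≡top : L + + suc j ≡ (c + + 1) + + suc k
        t≡top = trans (+suc≡1++ L j) (trans (cong (_+_ (+ 1)) L+j≡c+k) (regroup c (+ suc k)))
          where
          regroup : ∀ c k → + 1 + (c + k) ≡ (c + + 1) + k
          regroup = solve-∀
        isPartition′ : IsPartition (suc k ∷ beads)
        isPartition′ with beads | isPartition | top≤
        ... | []     | _          | _     = [-] , s≤s z≤n All.∷ All.[]
        ... | m ∷ l  | (ml , l>0) | top≤′ =
          drop‿+≤+ (+-cancelˡ-≤ c (≤-trans top≤′ (≤-reflexive L+j≡c+k))) Linked.∷ ml , s≤s z≤n All.∷ l>0
        sound′ : ∀ x → Beads (c + + 1) (suc k ∷ beads) x → P x × x ≤ L + + suc j
        sound′ x (inj₁ x≡top) = subst P (trans (sym t≡top′) (sym x≡top)) Pt , ≤-reflexive (trans x≡top t≡top′)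
          where
          t≡top′ : + suc k + (c + + 1) ≡ L + + suc j
          t≡top′ = trans (+-comm (+ suc k) (c + + 1)) (sym t≡top)
        sound′ x (inj₂ b) = proj₁ old , ≤+⇒≤+suc L j (proj₂ old)
          where
          old : P x × x ≤ L + + j
          old = sound x (subst (λ c → Beads c beads x) (i+1-1≡i c) b)
        complete′ : ∀ x → P x → x ≤ L + + suc j → Beads (c + + 1) (suc k ∷ beads) x
        complete′ x Px x≤ with ≤+suc⇒≡⊎≤+ L j x≤
        ... | inj₁ refl = inj₁ (trans t≡top (+-comm (c + + 1) (+ suc k)))
        ... | inj₂ x≤′  = inj₂ (subst (λ c → Beads c beads x) (sym (i+1-1≡i c)) (complete x Px x≤′))

    scan : ∀ j → Scanned j
    scan zero = start
    scan (suc j) with scan j | P? (L + + suc j)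
    ... | s | no ¬Pt = skip s ¬Pt
    ... | s | yes Pt with ≤⇒∃ (≤-trans (i≤i+j (Scanned.c s) (+ at (Scanned.beads s) 0)) (Scanned.top≤ s))
    ...   | zero  , L+j≡c+0 = take-empty s Pt L+j≡c+0
    ...   | suc k , L+j≡c+k = take-part s Pt k L+j≡c+k

  Beads-shift : ∀ c d l {x} → Beads c l x → Beads (c + d) l (x + d)
  Beads-shift c d []      x≤c         = +-monoˡ-≤ d x≤c
  Beads-shift c d (m ∷ l) (inj₁ refl) = inj₁ (+-assoc (+ m) c d)
  Beads-shift c d (m ∷ l) (inj₂ b)    = inj₂ (subst (λ c → Beads c l _) (c-1+d≡c+d-1 c d) (Beads-shift (c - + 1) d l b))
    where
    c-1+d≡c+d-1 : ∀ c d → (c - + 1) + d ≡ c + d - + 1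
    c-1+d≡c+d-1 = solve-∀

  Beads-unshift : ∀ c d l {x} → Beads (c + d) l (x + d) → Beads c l x
  Beads-unshift c d l {x} b = subst₂ (λ c x → Beads c l x) (i+d-d≡i c d) (i+d-d≡i x d) (Beads-shift (c + d) (- d) l b)
    where
    i+d-d≡i : ∀ i d → i + d + - d ≡ i
    i+d-d≡i = solve-∀

  -- Periodic functions

  sup : ∀ {n} → (Fin n → ℕ) → ℕ
  sup {zero}  f = 0
  sup {suc n} f = f Fin.zero ℕ.⊔ sup (f ∘ Fin.suc)

  ≤sup : ∀ {n} (f : Fin n → ℕ) i → f i ℕ.≤ sup f
  ≤sup f Fin.zero    = ℕₚ.m≤m⊔n _ _
  ≤sup f (Fin.suc i) = ℕₚ.≤-trans (≤sup (f ∘ Fin.suc) i) (ℕₚ.m≤n⊔m _ _)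

  i≤∣i∣ : ∀ i → i ≤ + ∣ i ∣
  i≤∣i∣ (+ n)    = ≤-refl
  i≤∣i∣ -[1+ n ] = -≤+

  -∣i∣≤i : ∀ i → - + ∣ i ∣ ≤ i
  -∣i∣≤i (+ zero)  = ≤-refl
  -∣i∣≤i (+ suc n) = -≤+
  -∣i∣≤i -[1+ n ]  = ≤-refl

  module _ (e : ℕ) .{{_ : ℕ.NonZero e}} where

    private
      quotient-≮ : ∀ r r′ q q′ → r ℕ.< e → + r + q * + e ≡ + r′ + q′ * + e → q < q′ → ⊥
      quotient-≮ r r′ q q′ r<e eq q<q′ with <⇒∃ q<q′
      ... | k , refl = ℕₚ.<⇒≱ r<e (subst (e ℕ.≤_) (sym r≡) (ℕₚ.≤-trans (ℕₚ.m≤n*m e (suc k)) (ℕₚ.m≤n+m _ r′)))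
        where
        regroup : ∀ r q k e → r + (q + k) * e ≡ (r + k * e) + q * e
        regroup = solve-∀
        r≡ : r ≡ r′ ℕ.+ suc k ℕ.* e
        r≡ = +-injective (∙-cancelʳ (q * + e) _ _ (trans eq (trans (regroup (+ r′) q (+ suc k) (+ e))
               (cong (λ m → (+ r′ + m) + q * + e) (sym (pos-* (suc k) e))))))

    %ℕ-unique : ∀ r r′ q q′ → r ℕ.< e → r′ ℕ.< e → + r + q * + e ≡ + r′ + q′ * + e → r ≡ r′
    %ℕ-unique r r′ q q′ r<e r′<e eq with <-cmp q q′
    ... | tri< q<q′ _ _ = ⊥-elim (quotient-≮ r r′ q q′ r<e eq q<q′)
    ... | tri≈ _ refl _ = +-injective (∙-cancelʳ (q * + e) (+ r) (+ r′) eq)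
    ... | tri> _ _ q′<q = ⊥-elim (quotient-≮ r′ r q′ q r′<e (sym eq) q′<q)

    residue : ℤ → Fin e
    residue i = fromℕ< (n%ℕd<d i e)

    i≡residue+quotient : ∀ i → i ≡ + toℕ (residue i) + (i /ℕ e) * + e
    i≡residue+quotient i = trans (a≡a%ℕn+[a/ℕn]*n i e) (cong (λ k → + k + (i /ℕ e) * + e) (sym (Finₚ.toℕ-fromℕ< _)))

    residue-unique : ∀ (r : Fin e) q → residue (+ toℕ r + q * + e) ≡ r
    residue-unique r q = Finₚ.toℕ-injective (trans (Finₚ.toℕ-fromℕ< _)
      (%ℕ-unique _ (toℕ r) ((+ toℕ r + q * + e) /ℕ e) q (n%ℕd<d (+ toℕ r + q * + e) e) (Finₚ.toℕ<n r)
        (sym (a≡a%ℕn+[a/ℕn]*n (+ toℕ r + q * + e) e))))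

  Periodic : ℕ → (ℤ → ℤ) → Set
  Periodic e w = ∀ i → w (i + + e) ≡ w i + + e

  module _ {e : ℕ} (w : ℤ → ℤ) (w-periodic : Periodic e w) where

    periodic-+ : ∀ i n → w (i + + n * + e) ≡ w i + + n * + e
    periodic-+ i zero    = trans (cong w (i+0*e≡i i (+ e))) (sym (i+0*e≡i (w i) (+ e)))
    periodic-+ i (suc n) = begin
      w (i + + suc n * + e)        ≡⟨ cong w (i+[1+n]*e≡i+n*e+e i (+ n) (+ e)) ⟩
      w (i + + n * + e + + e)      ≡⟨ w-periodic (i + + n * + e) ⟩
      w (i + + n * + e) + + e      ≡⟨ cong (_+ + e) (periodic-+ i n) ⟩
      w i + + n * + e + + e        ≡⟨ sym (i+[1+n]*e≡i+n*e+e (w i) (+ n) (+ e)) ⟩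
      w i + + suc n * + e          ∎
      where
      open ≡-Reasoning
      i+[1+n]*e≡i+n*e+e : ∀ i n e → i + (+ 1 + n) * e ≡ (i + n * e) + e
      i+[1+n]*e≡i+n*e+e = solve-∀

    periodic-* : ∀ i q → w (i + q * + e) ≡ w i + q * + e
    periodic-* i (+ n)    = periodic-+ i n
    periodic-* i -[1+ n ] = ∙-cancelʳ (+ suc n * + e) _ _ (begin
      w (i + -[1+ n ] * + e) + + suc n * + e                  ≡⟨ sym (periodic-+ _ (suc n)) ⟩
      w (i + -[1+ n ] * + e + + suc n * + e)                   ≡⟨ cong w (cancel i (+ n) (+ e)) ⟩
      w i                                                      ≡⟨ cancel (w i) (+ n) (+ e) ⟨
      w i + -[1+ n ] * + e + + suc n * + e                     ∎)
      where
      open ≡-Reasoning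
      cancel : ∀ i n e → i + - (+ 1 + n) * e + (+ 1 + n) * e ≡ i
      cancel = solve-∀

    periodic-back : ∀ i → w (i - + e) + + e ≡ w i
    periodic-back i = trans (sym (w-periodic (i - + e))) (cong w (i-e+e≡i i (+ e)))
      where
      i-e+e≡i : ∀ i e → i - e + e ≡ i
      i-e+e≡i = solve-∀

    module _ .{{_ : ℕ.NonZero e}} where

      displacement : ℕ
      displacement = sup (λ (r : Fin e) → ∣ w (+ toℕ r) - + toℕ r ∣)

      displacement-bound : ∀ i → ∣ w i - i ∣ ℕ.≤ displacement
      displacement-bound i = subst (ℕ._≤ displacement) (cong ∣_∣ (sym displacement≡))
                               (≤sup (λ (r : Fin e) → ∣ w (+ toℕ r) - + toℕ r ∣) (residue e i))
        where
        r : ℤ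
        r = + toℕ (residue e i)
        q : ℤ
        q = i /ℕ e
        displacement≡ : w i - i ≡ w r - r
        displacement≡ = begin
          w i - i                    ≡⟨ cong₂ (λ j k → w j - k) i≡ i≡ ⟩
          w (r + q * + e) - (r + q * + e)  ≡⟨ cong (_- (r + q * + e)) (periodic-* r q) ⟩
          w r + q * + e - (r + q * + e)    ≡⟨ cancel (w r) r (q * + e) ⟩
          w r - r                    ∎
          where
          open ≡-Reasoning
          i≡ : i ≡ r + q * + e
          i≡ = i≡residue+quotient e i
          cancel : ∀ a r m → a + m - (r + m) ≡ a - r
          cancel = solve-∀

  -- From affine permutations to cores

  image-emptyAbacus≐Below : ∀ w c → image w (abacus c emptyP) ≐ Below w c
  image-emptyAbacus≐Below w c = (λ { x (j , j∈ , refl) → j , listAbacus⇒Beads c [] j∈ , refl })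
                              , (λ { x (j , j≤ , refl) → j , Beads⇒listAbacus c [] j≤ , refl })

  module _ {e : ℕ} (μ : Tuple e) (F : ℤ → Subset) (μ≐F : ∀ r → Ab μ r ≐ F (+ toℕ r)) where

    isCore : (∀ k → F (+ k) ⊆ F (+ suc k)) → F (+ ℕ.pred e) ⊆ shift e (F (+ 0)) → IsCore e μ
    isCore F-step F-wrap = record
      { chain = λ k k+1<e x → to (fromℕ< k+1<e) ∘ subst (λ k → F (+ k) x) (sym (Finₚ.toℕ-fromℕ< k+1<e))
                           ∘ F-step k x ∘ subst (λ k → F (+ k) x) (Finₚ.toℕ-fromℕ< _) ∘ from _
      ; wrap  = λ 0<e e-1<e x Ab-x → wrap-shift 0<e (F-wrap x (subst (λ k → F (+ k) x) (Finₚ.toℕ-fromℕ< e-1<e) (from _ Ab-x)))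
      }
      where
      to : ∀ r {x} → F (+ toℕ r) x → Ab μ r x
      to r = proj₂ (μ≐F r) _
      from : ∀ r {x} → Ab μ r x → F (+ toℕ r) x
      from r = proj₁ (μ≐F r) _
      wrap-shift : ∀ (0<e : 0 ℕ.< e) {x} → shift e (F (+ 0)) x → shift e (Ab μ (fromℕ< 0<e)) x
      wrap-shift 0<e (a , Fa , x≡) = a , to (fromℕ< 0<e) (subst (λ k → F (+ k) a) (sym (Finₚ.toℕ-fromℕ< 0<e)) Fa) , x≡

  ≐-trans : ∀ {A B C : Subset} → A ≐ B → B ≐ C → A ≐ C
  ≐-trans (A⊆B , B⊆A) (B⊆C , C⊆B) = (λ x → B⊆C x ∘ A⊆B x) , (λ x → B⊆A x ∘ C⊆B x)

  ≐-sym : ∀ {A B : Subset} → A ≐ B → B ≐ A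
  ≐-sym (A⊆B , B⊆A) = B⊆A , A⊆B

  listAbacus≐Beads : ∀ c l → listAbacus c l ≐ Beads c l
  listAbacus≐Beads c l = (λ _ → listAbacus⇒Beads c l) , (λ _ → Beads⇒listAbacus c l)

  module FromAffinePerm (e : ℕ) .{{_ : ℕ.NonZero e}} (w : ℤ → ℤ) (w-affine : IsAffinePerm e w) where

    open IsAffinePerm w-affine

    private
      w⁻¹ : ℤ → ℤ
      w⁻¹ y = proj₁ (proj₂ bijective y)

      w∘w⁻¹ : ∀ y → w (w⁻¹ y) ≡ y
      w∘w⁻¹ y = proj₂ (proj₂ bijective y) refl

      D : ℕ
      D = displacement w periodic

      w≤i+D : ∀ i → w i ≤ i + + D
      w≤i+D i = subst (_≤ i + + D) (i+[j-i]≡j i (w i))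
                  (+-monoʳ-≤ i (≤-trans (i≤∣i∣ (w i - i)) (+≤+ (displacement-bound w periodic i))))
        where
        i+[j-i]≡j : ∀ i j → i + (j - i) ≡ j
        i+[j-i]≡j = solve-∀

      i≤w+D : ∀ i → i ≤ w i + + D
      i≤w+D i = subst₂ _≤_ (cancel₁ i (+ D)) (cancel₂ i (w i) (+ D))
                  (+-monoˡ-≤ (i + + D) (≤-trans (neg-mono-≤ (+≤+ (displacement-bound w periodic i))) (-∣i∣≤i (w i - i))))
        where
        cancel₁ : ∀ i d → - d + (i + d) ≡ i
        cancel₁ = solve-∀
        cancel₂ : ∀ i j d → (j - i) + (i + d) ≡ j + d
        cancel₂ = solve-∀

    Below? : ∀ i → Decidable (Below w i)
    Below? i x with w⁻¹ x ≤? i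
    ... | yes ≤i = yes (w⁻¹ x , ≤i , w∘w⁻¹ x)
    ... | no ≰i  = no λ { (j , j≤i , refl) → ≰i (subst (_≤ i) (sym (proj₁ bijective (w∘w⁻¹ (w j)))) j≤i) }

    private
      Below-step : ∀ i → Below w i ⊆ Below w (i + + 1)
      Below-step i x (j , j≤i , wj≡x) = j , ≤-trans j≤i (i≤i+j i (+ 1)) , wj≡x

      w∉Below : ∀ i → ¬ Below w i (w (i + + 1))
      w∉Below i (j , j≤i , wj≡) =
        +suc≰+ i 0 (subst (_≤ i + + 0) (proj₁ bijective wj≡) (≤-trans j≤i (≤-reflexive (sym (+-identityʳ i)))))

      Below-new : ∀ i x → Below w (i + + 1) x → Below w i x ⊎ x ≡ w (i + + 1)
      Below-new i x (j , j≤ , wj≡x) with ≤+suc⇒≡⊎≤+ i 0 j≤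
      ... | inj₁ refl = inj₂ (sym wj≡x)
      ... | inj₂ j≤i  = inj₁ (j , ≤-trans j≤i (≤-reflexive (+-identityʳ i)) , wj≡x)

      Below-low : ∀ i x → x + + D ≤ i → Below w i x
      Below-low i x x+D≤i =
        w⁻¹ x , ≤-trans (≤-trans (i≤w+D (w⁻¹ x)) (≤-reflexive (cong (_+ + D) (w∘w⁻¹ x)))) x+D≤i , w∘w⁻¹ x

      Below-high : ∀ i x → i + + D < x → ¬ Below w i x
      Below-high i x i+D<x (j , j≤i , refl) = <-irrefl refl (<-≤-trans i+D<x (≤-trans (w≤i+D j) (+-monoˡ-≤ (+ D) j≤i)))

      Below-shift : ∀ x → Below w (+ 0) x → Below w (+ e) (x + + e)
      Below-shift x (j , j≤0 , refl) = j + + e , +-monoˡ-≤ (+ e) j≤0 , periodic j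

      Below-unshift : ∀ x → Below w (+ e) (x + + e) → Below w (+ 0) x
      Below-unshift x (j , j≤e , wj≡) =
        j - + e , i≤j⇒i-j≤0 j≤e , ∙-cancelʳ (+ e) _ _ (trans (periodic-back w periodic j) wj≡)

    open Flag (Below w) Below? w D Below-step (λ i → i , ≤-refl , refl) w∉Below Below-new Below-low Below-high
    open FlagSum e Below-shift Below-unshift

    charge₀≡0 : charge₀ ≡ + 0
    charge₀≡0 = *-cancelˡ-≡ (+ e) charge₀ (+ 0) (∙-cancelʳ (+ triangular e) _ _ (begin
      + e * charge₀ + + triangular e  ≡⟨ sym sumW≡ ⟩
      sumW w e                        ≡⟨ sumCond ⟩
      + ((e ℕ.* suc e) ℕ./ 2)         ≡⟨ cong +_ (sym (triangular≡ e)) ⟩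
      + triangular e                  ≡⟨ cong (_+ + triangular e) (sym (*-zeroʳ (+ e))) ⟩
      + e * + 0 + + triangular e      ∎))
      where open ≡-Reasoning

    Below-isAbacus : ∀ k → k ℕ.≤ e → ∃[ l ] IsPartition l × Beads (+ k) l ≐ Below w (+ k)
    Below-isAbacus k k≤e = beads , isPartition , sound′ , complete′
      where
      open Scanned (scan (Below? (+ k)) L (≤L⇒B k) N)
      c≡k : c ≡ + k
      c≡k = trans c≡ (trans (charge-walk k k≤e) (trans (cong (_+_ (+ k)) charge₀≡0) (+-identityʳ (+ k))))
      sound′ : Beads (+ k) beads ⊆ Below w (+ k)
      sound′ x = proj₁ ∘ sound x ∘ subst (λ c → Beads c beads x) (sym c≡k)
      complete′ : Below w (+ k) ⊆ Beads (+ k) beads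
      complete′ x Bx = subst (λ c → Beads c beads x) c≡k (complete x Bx (≮⇒≥ (λ L+N<x → >L+N⇒∉B k k≤e x L+N<x Bx)))

    private
      beadsOf : (r : Fin e) → ∃[ l ] IsPartition l × Beads (+ toℕ r) l ≐ Below w (+ toℕ r)
      beadsOf r = Below-isAbacus (toℕ r) (ℕₚ.<⇒≤ (Finₚ.toℕ<n r))

    μ : Tuple e
    μ r = mkPartition (proj₁ (beadsOf r)) (proj₁ (proj₁ (proj₂ (beadsOf r)))) (proj₂ (proj₁ (proj₂ (beadsOf r))))

    μ≐Below : ∀ r → Ab μ r ≐ Below w (+ toℕ r)
    μ≐Below r = ≐-trans (listAbacus≐Beads (+ toℕ r) (proj₁ (beadsOf r))) (proj₂ (proj₂ (beadsOf r)))

    μ-isCore : IsCore e μ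
    μ-isCore = isCore μ (Below w) μ≐Below B-step-ℕ wrap
      where
      wrap : Below w (+ ℕ.pred e) ⊆ shift e (Below w (+ 0))
      wrap x (j , j≤ , refl) = w (j - + e) , (j - + e , j-e≤0 , refl) , sym (periodic-back w periodic j)
        where
        j-e≤0 : j - + e ≤ + 0
        j-e≤0 = i≤j⇒i-j≤0 (≤-trans j≤ (+≤+ ℕₚ.pred[n]≤n))

    μ-acts : ActsEmpty e w μ
    μ-acts r = ≐-trans (μ≐Below r) (≐-sym (image-emptyAbacus≐Below w (charge r)))

  -- Uniqueness

  Below-translate : ∀ {e} w → Periodic e w → ∀ q {i x} → Below w i x → Below w (i + q * + e) (x + q * + e)
  Below-translate w w-periodic q {i} (j , j≤i , refl) = j + q * + _ , +-monoˡ-≤ (q * + _) j≤i , periodic-* w w-periodic j q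

  acts⇒Below⊆ : ∀ {e w w′} {μ : Tuple e} → ActsEmpty e w μ → ActsEmpty e w′ μ →
                ∀ r → Below w (+ toℕ r) ⊆ Below w′ (+ toℕ r)
  acts⇒Below⊆ {w = w} {w′} acts acts′ r x = proj₁ (image-emptyAbacus≐Below w′ (charge r)) x ∘ proj₁ (acts′ r) x
                                           ∘ proj₂ (acts r) x ∘ proj₂ (image-emptyAbacus≐Below w (charge r)) x

  module _ (e : ℕ) .{{_ : ℕ.NonZero e}} {w w′ : ℤ → ℤ} (w-periodic : Periodic e w) (w′-periodic : Periodic e w′)
           {μ : Tuple e} (acts : ActsEmpty e w μ) (acts′ : ActsEmpty e w′ μ) where

    Below⊆Below′ : ∀ i → Below w i ⊆ Below w′ i
    Below⊆Below′ i x Bx = subst₂ (Below w′) (sym i≡) (x-qe+qe≡x x q (+ e)) (Below-translate w′ w′-periodic q at-residue)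
      where
      r : Fin e
      r = residue e i
      q : ℤ
      q = i /ℕ e
      i≡ : i ≡ + toℕ r + q * + e
      i≡ = i≡residue+quotient e i
      x-qe+qe≡x : ∀ x q e → x + - q * e + q * e ≡ x
      x-qe+qe≡x = solve-∀
      r+qe-qe≡r : ∀ r q e → r + q * e + - q * e ≡ r
      r+qe-qe≡r = solve-∀
      i-qe≡r : i + - q * + e ≡ + toℕ r
      i-qe≡r = trans (cong (λ j → j + - q * + e) i≡) (r+qe-qe≡r (+ toℕ r) q (+ e))
      at-residue : Below w′ (+ toℕ r) (x + - q * + e)
      at-residue = acts⇒Below⊆ {μ = μ} acts acts′ r _
                     (subst (λ j → Below w j (x + - q * + e)) i-qe≡r (Below-translate w w-periodic (- q) Bx))

  Below-determines-value : ∀ {w w′ : ℤ → ℤ} → (∀ {x y} → w x ≡ w y → x ≡ y) → ∀ i →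
                           Below w i ⊆ Below w′ i → Below w′ (ℤ.pred i) ⊆ Below w (ℤ.pred i) → w i ≡ w′ i
  Below-determines-value {w} {w′} w-injective i B⊆B′ B′⊆B with B⊆B′ (w i) (i , ≤-refl , refl)
  ... | j , j≤i , w′j≡wi with j ≤? ℤ.pred i
  ...   | no j≰pred[i] =
    trans (sym w′j≡wi) (cong w′ (≤-antisym j≤i (subst (_≤ j) (suc-pred i) (i<j⇒suc[i]≤j (≰⇒> j≰pred[i])))))
  ...   | yes j≤pred[i] with B′⊆B (w′ j) (j , j≤pred[i] , refl)
  ...     | k , k≤pred[i] , wk≡w′j =
    ⊥-elim (<-irrefl refl (i≤pred[j]⇒i<j (subst (_≤ ℤ.pred i) (w-injective (trans wk≡w′j w′j≡wi)) k≤pred[i])))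

  ActsEmpty-injective : ∀ {e} .{{_ : ℕ.NonZero e}} {w w′ : ℤ → ℤ} {μ : Tuple e} →
                        IsAffinePerm e w → IsAffinePerm e w′ → ActsEmpty e w μ → ActsEmpty e w′ μ → ∀ i → w i ≡ w′ i
  ActsEmpty-injective {e} {μ = μ} w-affine w′-affine acts acts′ i =
    Below-determines-value (proj₁ (bijective w-affine)) i
      (Below⊆Below′ e (periodic w-affine) (periodic w′-affine) {μ} acts acts′ i)
      (Below⊆Below′ e (periodic w′-affine) (periodic w-affine) {μ} acts′ acts (ℤ.pred i))
    where open IsAffinePerm

  -- From cores to affine permutations

  module _ {e : ℕ} {μ : Tuple e} (μ-core : IsCore e μ) where

    private
      Ab-cong : ∀ {r s : Fin e} → toℕ r ≡ toℕ s → Ab μ r ⊆ Ab μ s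
      Ab-cong r≡s x = subst (λ t → Ab μ t x) (Finₚ.toℕ-injective r≡s)

    core-step : ∀ (r s : Fin e) → toℕ s ≡ suc (toℕ r) → Ab μ r ⊆ Ab μ s
    core-step r s s≡ x = Ab-cong (trans (Finₚ.toℕ-fromℕ< s<e) (sym s≡)) x
                       ∘ IsCore.chain μ-core (toℕ r) s<e x
                       ∘ Ab-cong (sym (Finₚ.toℕ-fromℕ< _)) x
      where
      s<e : suc (toℕ r) ℕ.< e
      s<e = subst (ℕ._< e) s≡ (Finₚ.toℕ<n s)

    core-wrap : ∀ (r s : Fin e) → suc (toℕ r) ≡ e → toℕ s ≡ 0 → Ab μ r ⊆ shift e (Ab μ s)
    core-wrap r s r+1≡e s≡0 x Ab-x with IsCore.wrap μ-core 0<e e-1<e x (Ab-cong r≡e-1 x Ab-x)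
      where
      0<e : 0 ℕ.< e
      0<e = subst (ℕ._< e) s≡0 (Finₚ.toℕ<n s)
      e-1<e : ℕ.pred e ℕ.< e
      e-1<e = subst (ℕ._< e) (cong ℕ.pred r+1≡e) (Finₚ.toℕ<n r)
      r≡e-1 : toℕ r ≡ toℕ (fromℕ< e-1<e)
      r≡e-1 = trans (cong ℕ.pred r+1≡e) (sym (Finₚ.toℕ-fromℕ< e-1<e))
    ... | a , Ab-a , x≡ = a , Ab-cong (trans (Finₚ.toℕ-fromℕ< _) (sym s≡0)) a Ab-a , x≡

  module FromCore (e : ℕ) .{{_ : ℕ.NonZero e}} (μ : Tuple e) (μ-core : IsCore e μ) where

    partsAt : ℤ → List ℕ
    partsAt i = parts (μ (residue e i))

    -- B (r + q e) is the abacus of μ r translated by q e.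
    B : ℤ → Subset
    B i = Beads i (partsAt i)

    B? : ∀ i → Decidable (B i)
    B? i = Beads? i (partsAt i)

    B⇒Ab : ∀ {i x} r q y → i ≡ + toℕ r + q * + e → x ≡ y + q * + e → B i x → Ab μ r y
    B⇒Ab r q y refl refl =
      let i = + toℕ r + q * + e ; x = y + q * + e in
      Beads⇒listAbacus (+ toℕ r) (parts (μ r)) ∘ Beads-unshift (+ toℕ r) (q * + e) (parts (μ r))
      ∘ subst (λ s → Beads i (parts (μ s)) x) (residue-unique e r q)

    Ab⇒B : ∀ {i x} r q y → i ≡ + toℕ r + q * + e → x ≡ y + q * + e → Ab μ r y → B i x
    Ab⇒B r q y refl refl =
      let i = + toℕ r + q * + e ; x = y + q * + e in
      subst (λ s → Beads i (parts (μ s)) x) (sym (residue-unique e r q))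
      ∘ Beads-shift (+ toℕ r) (q * + e) (parts (μ r)) ∘ listAbacus⇒Beads (+ toℕ r) (parts (μ r))

    private
      x≡[x-a]+a : ∀ x a → x ≡ x - a + a
      x≡[x-a]+a = solve-∀

      0<e : 0 ℕ.< e
      0<e = ℕ.>-nonZero⁻¹ e

      step-at : ∀ {i x} (r : Fin e) q y → i ≡ + toℕ r + q * + e → x ≡ y + q * + e → Ab μ r y → B (i + + 1) x
      step-at {i} r q y i≡ x≡ Ab-y with ℕₚ.m≤n⇒m<n∨m≡n (Finₚ.toℕ<n r)
      ... | inj₁ r+1<e = Ab⇒B (fromℕ< r+1<e) q y i+1≡ x≡ (core-step μ-core r _ (Finₚ.toℕ-fromℕ< r+1<e) y Ab-y)
        where
        regroup : ∀ r a → r + a + + 1 ≡ + 1 + r + a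
        regroup = solve-∀
        i+1≡ : i + + 1 ≡ + toℕ (fromℕ< r+1<e) + q * + e
        i+1≡ = trans (cong (_+ + 1) i≡) (trans (regroup (+ toℕ r) (q * + e))
                     (cong (λ k → + k + q * + e) (sym (Finₚ.toℕ-fromℕ< r+1<e))))
      ... | inj₂ r+1≡e with core-wrap μ-core r (fromℕ< 0<e) r+1≡e (Finₚ.toℕ-fromℕ< 0<e) y Ab-y
      ...   | a , Ab-a , y≡a+e =
        Ab⇒B (fromℕ< 0<e) (q + + 1) a i+1≡ (trans x≡ (trans (cong (_+ q * + e) y≡a+e) (a+e+qe≡a+[q+1]e a q (+ e)))) Ab-a
        where
        [r+qe]+1≡[q+1]e : ∀ r q e → + 1 + r ≡ e → r + q * e + + 1 ≡ + 0 + (q + + 1) * e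
        [r+qe]+1≡[q+1]e r q e refl = at-1+r r q
          where
          at-1+r : ∀ r q → r + q * (+ 1 + r) + + 1 ≡ + 0 + (q + + 1) * (+ 1 + r)
          at-1+r = solve-∀
        a+e+qe≡a+[q+1]e : ∀ a q e → a + e + q * e ≡ a + (q + + 1) * e
        a+e+qe≡a+[q+1]e = solve-∀
        i+1≡ : i + + 1 ≡ + toℕ (fromℕ< 0<e) + (q + + 1) * + e
        i+1≡ = trans (cong (_+ + 1) i≡) (trans ([r+qe]+1≡[q+1]e (+ toℕ r) q (+ e) (cong +_ r+1≡e))
                     (cong (λ k → + k + (q + + 1) * + e) (sym (Finₚ.toℕ-fromℕ< 0<e))))

    B-step : ∀ i → B i ⊆ B (i + + 1)
    B-step i x Bix = step-at (residue e i) (i /ℕ e) y (i≡residue+quotient e i) (x≡[x-a]+a x _)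
                       (B⇒Ab (residue e i) (i /ℕ e) y (i≡residue+quotient e i) (x≡[x-a]+a x _) Bix)
      where
      y : ℤ
      y = x - (i /ℕ e) * + e

    private
      +e-decomposition : ∀ i → i + + e ≡ + toℕ (residue e i) + (i /ℕ e + + 1) * + e
      +e-decomposition i = trans (cong (_+ + e) (i≡residue+quotient e i)) (regroup (+ toℕ (residue e i)) (i /ℕ e) (+ e))
        where
        regroup : ∀ r q e → r + q * e + e ≡ r + (q + + 1) * e
        regroup = solve-∀

      x+e≡ : ∀ x i → x + + e ≡ (x - (i /ℕ e) * + e) + (i /ℕ e + + 1) * + e
      x+e≡ x i = regroup x (i /ℕ e) (+ e)
        where
        regroup : ∀ x q e → x + e ≡ (x - q * e) + (q + + 1) * e
        regroup = solve-∀

    B-shift : ∀ i x → B i x → B (i + + e) (x + + e)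
    B-shift i x = Ab⇒B (residue e i) (i /ℕ e + + 1) y (+e-decomposition i) (x+e≡ x i)
                ∘ B⇒Ab (residue e i) (i /ℕ e) y (i≡residue+quotient e i) (x≡[x-a]+a x _)
      where
      y : ℤ
      y = x - (i /ℕ e) * + e

    B-unshift : ∀ i x → B (i + + e) (x + + e) → B i x
    B-unshift i x = Ab⇒B (residue e i) (i /ℕ e) y (i≡residue+quotient e i) (x≡[x-a]+a x _)
                  ∘ B⇒Ab (residue e i) (i /ℕ e + + 1) y (+e-decomposition i) (x+e≡ x i)
      where
      y : ℤ
      y = x - (i /ℕ e) * + e

    extent : Fin e → ℕ
    extent r = length (parts (μ r)) ℕ.+ at (parts (μ r)) 0

    K : ℕ
    K = sup extent

    private
      length≤K : ∀ i → length (partsAt i) ℕ.≤ K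
      length≤K i = ℕₚ.≤-trans (ℕₚ.m≤m+n _ _) (≤sup extent (residue e i))

      largest≤K : ∀ i → at (partsAt i) 0 ℕ.≤ K
      largest≤K i = ℕₚ.≤-trans (ℕₚ.m≤n+m _ _) (≤sup extent (residue e i))

      isPartitionAt : ∀ i → IsPartition (partsAt i)
      isPartitionAt i = decreasing (μ (residue e i)) , positive (μ (residue e i))

      +K≤⇒≤-length : ∀ {x i} → x + + K ≤ i → x ≤ i - + length (partsAt i)
      +K≤⇒≤-length {x} {i} x+K≤i = ≤-trans (≤-reflexive (x≡x+n-n x (+ length (partsAt i))))
                                      (+-monoˡ-≤ (- + length (partsAt i)) (≤-trans (+-monoʳ-≤ x (+≤+ (length≤K i))) x+K≤i))
        where
        x≡x+n-n : ∀ x n → x ≡ x + n - n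
        x≡x+n-n = solve-∀

    B-low : ∀ i x → x + + K ≤ i → B i x
    B-low i x x+K≤i = Beads-low i (partsAt i) x (+K≤⇒≤-length x+K≤i)

    B-high : ∀ i x → i + + K < x → ¬ B i x
    B-high i x i+K<x Bix = <-irrefl refl (<-≤-trans i+K<x (≤-trans (Beads-high i (partsAt i) x (isPartitionAt i) Bix)
                                                            (+-monoʳ-≤ i (+≤+ (largest≤K i)))))

    B-charge : ∀ i L n → L + + K ≤ i → i + + K ≤ L + + n → L + + count (B? i) L n ≡ i
    B-charge i L n L+K≤i i+K≤ = Beads-charge i (partsAt i) L n (isPartitionAt i) (+K≤⇒≤-length L+K≤i)
                                  (≤-trans (+-monoʳ-≤ i (+≤+ (largest≤K i))) i+K≤)

    private
      window-start : ℤ → ℤ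
      window-start i = i - + K

      window-size : ℕ
      window-size = suc (K ℕ.+ K)

      start+K≡i : ∀ i → window-start i + + K ≡ i
      start+K≡i i = i-K+K≡i i (+ K)
        where
        i-K+K≡i : ∀ i K → i - K + K ≡ i
        i-K+K≡i = solve-∀

      end≡i+1+K : ∀ i → window-start i + + window-size ≡ (i + + 1) + + K
      end≡i+1+K i = regroup i (+ K)
        where
        regroup : ∀ i K → i - K + (+ 1 + (K + K)) ≡ (i + + 1) + K
        regroup = solve-∀

      charge-in-window : ∀ i → window-start i + + count (B? i) (window-start i) window-size ≡ i
      charge-in-window i = B-charge i (window-start i) window-size (≤-reflexive (start+K≡i i))
                             (≤-trans (+-monoˡ-≤ (+ K) (i≤i+j i (+ 1))) (≤-reflexive (sym (end≡i+1+K i))))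

      charge+1-in-window : ∀ i → window-start i + + count (B? (i + + 1)) (window-start i) window-size ≡ i + + 1
      charge+1-in-window i = B-charge (i + + 1) (window-start i) window-size (≤-trans (≤-reflexive (start+K≡i i)) (i≤i+j i (+ 1)))
                               (≤-reflexive (sym (end≡i+1+K i)))

      count-suc : ∀ i → count (B? (i + + 1)) (window-start i) window-size ≡ suc (count (B? i) (window-start i) window-size)
      count-suc i = +-injective (∙-cancelˡ s _ _ (begin
        s + + c₁        ≡⟨ charge+1-in-window i ⟩
        i + + 1         ≡⟨ cong (_+ + 1) (sym (charge-in-window i)) ⟩
        s + + c₀ + + 1  ≡⟨ sym (i+[1+k]≡[i+k]+1 s (+ c₀)) ⟩
        s + + suc c₀    ∎))
        where
        open ≡-Reasoning
        s : ℤ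
        s = window-start i
        c₀ c₁ : ℕ
        c₀ = count (B? i) s window-size
        c₁ = count (B? (i + + 1)) s window-size

      new∈window : ∀ i z → B (i + + 1) z → ¬ B i z → InWindow (window-start i) window-size z
      new∈window i z B′z ¬Bz =
        ≰⇒> (λ z≤start → ¬Bz (B-low i z (≤-trans (+-monoˡ-≤ (+ K) z≤start) (≤-reflexive (start+K≡i i))))) ,
        ≮⇒≥ (λ end<z → B-high (i + + 1) z (subst (_< z) (end≡i+1+K i) end<z) B′z)

      newBead-spec : ∀ i → ∃[ y ] InWindow (window-start i) window-size y × B (i + + 1) y × ¬ B i y
      newBead-spec i = count-<⇒∃ (B? i) (B? (i + + 1)) (window-start i) window-size (ℕₚ.≤-reflexive (sym (count-suc i)))

    newBead : ℤ → ℤ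
    newBead i = proj₁ (newBead-spec i)

    newBead-∈ : ∀ i → B (i + + 1) (newBead i)
    newBead-∈ i = proj₁ (proj₂ (proj₂ (newBead-spec i)))

    newBead-∉ : ∀ i → ¬ B i (newBead i)
    newBead-∉ i = proj₂ (proj₂ (proj₂ (newBead-spec i)))

    newBead-unique : ∀ i z → B (i + + 1) z → ¬ B i z → z ≡ newBead i
    newBead-unique i z B′z ¬Bz = count-suc⇒unique (B? i) (B? (i + + 1)) (window-start i) window-size (B-step i) (count-suc i)
                                   (new∈window i z B′z ¬Bz) B′z ¬Bz
                                   (new∈window i _ (newBead-∈ i) (newBead-∉ i)) (newBead-∈ i) (newBead-∉ i)

    w : ℤ → ℤ
    w i = newBead (i - + 1)

    private
      w∈B : ∀ i → B i (w i)
      w∈B i = subst (λ j → B j (w i)) (i-1+1≡i i) (newBead-∈ (i - + 1))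

      w∉B : ∀ i → ¬ B i (w (i + + 1))
      w∉B i = newBead-∉ (i + + 1 - + 1) ∘ subst (λ j → B j (w (i + + 1))) (sym (i+1-1≡i i))

      B-new : ∀ i x → B (i + + 1) x → B i x ⊎ x ≡ w (i + + 1)
      B-new i x B′x with B? i x
      ... | yes Bx = inj₁ Bx
      ... | no ¬Bx = inj₂ (trans (newBead-unique i x B′x ¬Bx) (cong newBead (sym (i+1-1≡i i))))

    w-periodic : Periodic e w
    w-periodic i = sym (newBead-unique j (w i + + e) in-next out-of-j)
      where
      j : ℤ
      j = i + + e - + 1
      in-next : B (j + + 1) (w i + + e)
      in-next = subst (λ k → B k (w i + + e)) (sym (i-1+1≡i (i + + e))) (B-shift i (w i) (w∈B i))
      out-of-j : ¬ B j (w i + + e)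
      out-of-j = newBead-∉ (i - + 1) ∘ B-unshift (i - + 1) (w i) ∘ subst (λ k → B k (w i + + e)) (regroup i (+ e))
        where
        regroup : ∀ i e → i + e - + 1 ≡ i - + 1 + e
        regroup = solve-∀

    open Flag B B? w K B-step w∈B w∉B B-new B-low B-high
    open FlagSum e (B-shift (+ 0)) (B-unshift (+ 0))

    w-affine : IsAffinePerm e w
    w-affine = record
      { bijective = w-injective , λ y → proj₁ (w-surjective y) , λ { refl → proj₂ (w-surjective y) }
      ; periodic  = w-periodic
      ; sumCond   = begin
          sumW w e                                ≡⟨ sumW≡ ⟩
          + e * charge₀ + + triangular e          ≡⟨ cong (λ c → + e * c + + triangular e) charge₀≡0 ⟩
          + e * + 0 + + triangular e              ≡⟨ cong (_+ + triangular e) (*-zeroʳ (+ e)) ⟩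
          + triangular e                          ≡⟨ cong +_ (triangular≡ e) ⟩
          + ((e ℕ.* suc e) ℕ./ 2)                 ∎
      }
      where
      open ≡-Reasoning
      charge₀≡0 : charge₀ ≡ + 0
      charge₀≡0 = B-charge (+ 0) L N (≤-reflexive (L+K≡0 (+ K) (+ e)))
                    (≤-trans (i≤i+j (+ 0 + + K) (+ e)) (≤-reflexive (sym (L+N≡K+e (+ K) (+ e)))))
        where
        L+K≡0 : ∀ K e → (- K - e) + e + K ≡ + 0
        L+K≡0 = solve-∀
        L+N≡K+e : ∀ K e → (- K - e) + e + (K + K + e) ≡ + 0 + K + e
        L+N≡K+e = solve-∀

    w-acts : ActsEmpty e w μ
    w-acts r = ≐-trans Ab≐B (≐-trans (B≐Below (+ toℕ r)) (≐-sym (image-emptyAbacus≐Below w (charge r))))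
      where
      i≡i+0*e : ∀ i → i ≡ i + + 0 * + e
      i≡i+0*e i = sym (i+0*e≡i i (+ e))
      Ab≐B : Ab μ r ≐ B (+ toℕ r)
      Ab≐B = (λ x → Ab⇒B r (+ 0) x (i≡i+0*e _) (i≡i+0*e x)) , (λ x → B⇒Ab r (+ 0) x (i≡i+0*e _) (i≡i+0*e x))

open import Data.Nat using (ℕ; _≤_)
open import Data.Integer using (ℤ)
open import Data.Product using (Σ; _×_; _,_)
open import Relation.Binary.PropositionalEquality using (_≡_)
import Data.Nat as ℕ
import Data.Nat.Properties as ℕₚ
open AffineCores

corollaryA8 : (e : ℕ) → 2 ≤ e →
    ((w : ℤ → ℤ) → IsAffinePerm e w →
      Σ (Tuple e) (λ μ → IsCore e μ × ActsEmpty e w μ))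
  × ((w w′ : ℤ → ℤ) (μ : Tuple e) → IsAffinePerm e w → IsAffinePerm e w′ →
      ActsEmpty e w μ → ActsEmpty e w′ μ → ∀ (i : ℤ) → w i ≡ w′ i)
  × ((μ : Tuple e) → IsCore e μ →
      Σ (ℤ → ℤ) (λ w → IsAffinePerm e w × ActsEmpty e w μ))
corollaryA8 e 2≤e =
  (λ w w-affine → let open FromAffinePerm e w w-affine in μ , μ-isCore , μ-acts) ,
  (λ w w′ μ → ActsEmpty-injective {μ = μ}) ,
  (λ μ μ-core → let open FromCore e μ μ-core in w , w-affine , w-acts)
  where
  -- 2 ≤ e is only needed to have e ≠ 0.
  instance
    e≢0 : ℕ.NonZero e
    e≢0 = ℕ.>-nonZero (ℕₚ.<-≤-trans (ℕ.s≤s ℕ.z≤n) 2≤e)
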